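{- Let $d,r\geq1$ and $A\in\mathcal{A}(r\Delta_{1,d})$. Then $\mathrm{comp}(A)\in\mathfrak{C}(r-1,d+1,r-j)$ for some $j\in\{1,2,\dots,d\}$, and for this $j$ we have $\sigma_A\in\mathfrak{A}(d,j)$.
   Context: $r\Delta_{1,d}=\{x\in\mathbb{R}^{d+1}: x_k\geq0,\ \sum_kx_k=r\}$; its alcoves are the maximal simplices of the subdivision by the hyperplanes $x_{a+1}+\dots+x_b=m$ ($0\leq a<b\leq d+1$, $m\in\mathbb{Z}$), identified with vertex sets $A=\{\vec a_1,\dots,\vec a_{d+1}\}\subset\mathbb{N}^{d+1}$. $\mathrm{comp}(A)=(c_1,\dots,c_{d+1})$ with $c_k=\min_{\vec v\in A}v_k$. $\mathfrak{C}(m,n,s)=\{(c_1,\dots,c_n)\in\mathbb{N}^n:\sum c_k=s,\ c_k\leq m\}$. $\mathfrak{A}(d,j)$ is the set of permutations of $[d]$ with exactly $j-1$ descents. For $\vec a$ with coordinate sum $r$, $I_{\vec a}$ is the $r$-multiset of $[d+1]$ with $a_t$ copies of $t$; vertices are ordered so that the multisets are sorted ($I_{11}\leq I_{21}\leq\dots\leq I_{(d+1)1}\leq I_{12}\leq\dots\leq I_{(d+1)r}$, where $I_{a}=\{I_{a1}\leq\dots\leq I_{ar}\}$). The decorated matrix is the $(d+1)\times r$ grid with rows $I_1,\dots,I_{d+1}$ where the edge between $(a,b)$ and $(a+1,b)$ is marked iff $I_{ab}<I_{(a+1)b}$; for alcoves of $r\Delta_{1,d}$ there is exactly one mark between rows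 $a$ and $a+1$ for each $1\leq a\leq d$ and no other marks. $\sigma_A$ is the permutation of $[d]$ whose one-line notation lists, for the marks read in order (columns left to right, within a column top to bottom), the index $a$ such that the mark lies between rows $a$ and $a+1$. -}

module Defs where

open import Data.Nat as ℕ using (ℕ; zero; suc; _≤_; _<_; _⊓_; _∸_)
open import Data.Integer as ℤ using (ℤ; +_)
import Data.Rational as ℚ
open ℚ using (ℚ; 0ℚ; _/_)

qfloor : ℚ → ℤ
qfloor = ℚ.floor
open import Data.Fin using (Fin; toℕ)
open import Data.Fin.Base using () renaming (zero to fzero)
open import Data.Vec as Vec using (Vec)
open import Data.List as List using (List; []; _∷_; concat; replicate; upTo; allFin; take; drop; foldr; _++_)
open import Data.List.Relation.Binary.Permutation.Propositional using (_↭_)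
open import Data.Product using (Σ; _×_; ∃)
open import Function.Bundles using (_⇔_)
open import Function.Definitions using (Injective)
open import Relation.Binary.PropositionalEquality using (_≡_; _≢_)
open import Relation.Nullary using (¬_)
open import Relation.Nullary.Decidable using (⌊_⌋)
open import Data.Bool using (if_then_else_)
open import Data.Nat.ListAction using () renaming (sum to sumℕ)

ℕ→ℚ : ℕ → ℚ
ℕ→ℚ n = (+ n) / 1

-- partial sum x_{a+1} + ... + x_b  (paper's 1-based coordinates), i.e. the
-- 0-based coordinates a, a+1, ..., b-1.
psumℕ : ∀ {n} → Vec ℕ n → ℕ → ℕ → ℕ
psumℕ x a b = sumℕ (take (b ∸ a) (drop a (Vec.toList x)))

psumℚ : ∀ {n} → Vec ℚ n → ℕ → ℕ → ℚ
psumℚ x a b = foldr ℚ._+_ 0ℚ (take (b ∸ a) (drop a (Vec.toList x)))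

-- A : Fin (d+1) → ℕ^{d+1}, an enumeration of d+1 lattice points, is (an
-- enumeration of the vertex set of) an alcove of rΔ_{1,d}:
-- the points are distinct, and there is a rational point p in the open
-- region (p lies in rΔ_{1,d} with all p_k > 0 and on none of the hyperplanes
-- x_{a+1}+...+x_b = m, (a,b) ≠ (0,d+1)) such that the lattice points of rΔ_{1,d}
-- lying in the closure of the region of p are exactly the points of A.
-- The closure of the region of p is
--   { q : ⌊s_ab(p)⌋ ≤ s_ab(q) ≤ ⌊s_ab(p)⌋ + 1 for all 0 ≤ a < b ≤ d+1 }.
IsAlcove : (r d : ℕ) → (Fin (suc d) → Vec ℕ (suc d)) → Set
IsAlcove r d A =
  Injective _≡_ _≡_ A ×
  Σ (Vec ℚ (suc d)) λ p →
    ((k : Fin (suc d)) → 0ℚ ℚ.< Vec.lookup p k) ×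
    (psumℚ p 0 (suc d) ≡ ℕ→ℚ r) ×
    ((a b : ℕ) → a < b → b ≤ suc d → ¬ (a ≡ 0 × b ≡ suc d) →
       (m : ℤ) → psumℚ p a b ≢ (m / 1)) ×
    ((v : Vec ℕ (suc d)) → Vec.sum v ≡ r →
       ((∃ λ i → A i ≡ v) ⇔
        ((a b : ℕ) → a < b → b ≤ suc d →
           (qfloor (psumℚ p a b) ℤ.≤ + psumℕ v a b) ×
           (+ psumℕ v a b ℤ.≤ qfloor (psumℚ p a b) ℤ.+ + 1))))

comp : ∀ {d} → (Fin (suc d) → Vec ℕ (suc d)) → Vec ℕ (suc d)
comp {d} A = Vec.tabulate λ k →
  foldr (λ i m → Vec.lookup (A i) k ⊓ m) (Vec.lookup (A fzero) k) (allFin (suc d))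

InC : (m n s : ℕ) → Vec ℕ n → Set
InC m n s c = (Vec.sum c ≡ s) × ((k : Fin n) → Vec.lookup c k ≤ m)

-- the multiset I_a of a vector a, as a sorted list over [d+1] = {1,...,d+1}
multiset : ∀ {n} → Vec ℕ n → List ℕ
multiset {n} x = concat (List.map (λ t → replicate (Vec.lookup x t) (suc (toℕ t))) (allFin n))

-- list lookup with default 0 (only used at indices < length)
nth : List ℕ → ℕ → ℕ
nth [] _ = 0
nth (x ∷ xs) zero = x
nth (x ∷ xs) (suc i) = nth xs i

-- entry I_{(a+1)(b+1)} of the decorated matrix (0-based row a, column b)
entry : ∀ {d} → (Fin (suc d) → Vec ℕ (suc d)) → Fin (suc d) → ℕ → ℕ
entry A a b = nth (multiset (A a)) b

-- rows as ℕ-indexed (0-based); rows ≥ d+1 never used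
row : ∀ {d} → (Fin (suc d) → Vec ℕ (suc d)) → ℕ → ℕ → ℕ
row {d} A a b with a ℕ.<? suc d
... | Relation.Nullary.yes a<  = entry A (Data.Fin.fromℕ< a<) b
... | Relation.Nullary.no  _   = 0

Sorted : (r d : ℕ) → (Fin (suc d) → Vec ℕ (suc d)) → Set
Sorted r d A =
  ((a b : ℕ) → suc a < suc d → b < r → row A a b ≤ row A (suc a) b) ×
  ((b : ℕ) → suc b < r → row A d b ≤ row A 0 (suc b))

-- σ_A: read marks column by column (left to right), within a column top to
-- bottom; a mark between rows a and a+1 (1-based) contributes a.
marksCol : ∀ {d} → (Fin (suc d) → Vec ℕ (suc d)) → ℕ → List ℕ
marksCol {d} A b =
  concat (List.map (λ a → if ⌊ row A a b ℕ.<? row A (suc a) b ⌋ then suc a ∷ [] else [])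
                   (upTo d))

sigma : (r d : ℕ) → (Fin (suc d) → Vec ℕ (suc d)) → List ℕ
sigma r d A = concat (List.map (marksCol A) (upTo r))

des : List ℕ → ℕ
des [] = 0
des (x ∷ []) = 0
des (x ∷ y ∷ xs) = (if ⌊ y ℕ.<? x ⌋ then 1 else 0) ℕ.+ des (y ∷ xs)

InEulerian : (d j : ℕ) → List ℕ → Set
InEulerian d j σ = (σ ↭ List.map suc (upTo d)) × (des σ ≡ j ∸ 1)

-- Write s a t for the t-th prefix sum of the a-th vertex. Rounding the prefix sums of an
-- interior point of the alcove, shifted so as to start at each of its first d + 1 prefix
-- sums, gives d + 1 distinct lattice points of rΔ_{1,d} in its closure; so these are the
-- vertices, and all of them lie on Σ = r. The closure confines each s · t to two consecutive
-- values, and the ordering of the vertices makes s a t decreasing in a. Consecutive vertices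
-- differ, so each of the d steps a → a + 1 lowers some prefix sum, while from the first to
-- the last vertex at most d prefix sums drop, by at most one each. Hence every step lowers
-- exactly one prefix sum, the (rank⁻¹ a + 1)-st, and rank is a permutation of [0, d).
-- The mark between rows a and a + 1 sits in column s d (rank⁻¹ a + 1), and ordering the
-- marks by column and then by row is ordering them by rank⁻¹ a, so
-- σ_A = (rank 0 + 1, …, rank (d - 1) + 1). Finally, coordinate k of comp(A) is that of the
-- last vertex, minus one exactly for k = d and where σ_A descends, so the coordinates of
-- comp(A) add up to r - j with j - 1 the number of descents of σ_A.

module Submission where

open import Defs
open import Data.Nat using (ℕ; suc; _≤_; _∸_)
open import Data.Fin using (Fin)
open import Data.Vec using (Vec)
open import Data.Product using (Σ; _×_)

open import Data.Bool using (if_then_else_)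
open import Data.Empty using (⊥-elim)
open import Data.Fin as Fin using (toℕ; fromℕ<)
import Data.Fin.Properties as Fin
open import Data.Integer as ℤ using (ℤ; +_; +≤+)
import Data.Integer.DivMod as ℤ
import Data.Integer.Properties as ℤ
open import Data.Integer.Tactic.RingSolver using (solve-∀)
open import Data.List as List using (List; []; _∷_; take; drop; _++_; foldr; replicate; concat; tabulate; filter; upTo; applyUpTo)
open import Data.List.Membership.Propositional using (_∈_)
import Data.List.Membership.Propositional.Properties as ∈
open import Data.List.Membership.Propositional.Properties.WithK using (unique∧set⇒bag)
open import Data.List.Properties
  using (take-[]; take-all; take-take; take++drop≡id; length-replicate; map-tabulate; map-cong-local; map-∘; map-applyUpTo)
open import Data.List.Relation.Binary.BagAndSetEquality using (∼bag⇒↭)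
open import Data.List.Relation.Binary.Permutation.Propositional using (_↭_)
import Data.List.Relation.Binary.Permutation.Propositional.Properties as ↭
open import Data.List.Relation.Unary.All as All using (All; []; _∷_)
import Data.List.Relation.Unary.All.Properties as All
open import Data.List.Relation.Unary.AllPairs as AllPairs using (AllPairs; []; _∷_)
import Data.List.Relation.Unary.AllPairs.Properties as AllPairs
open import Data.List.Relation.Unary.Any using (here; there)
open import Data.Nat as ℕ using (zero; _+_; _*_; _⊓_; _<_; z≤n; s≤s; s≤s⁻¹; _<?_; _≤?_; _≟_)
open import Data.Nat.GCD using (gcd-zeroʳ)
open import Data.Nat.ListAction using () renaming (sum to sumℕ)
open import Data.Nat.ListAction.Properties using () renaming (sum-++ to sumℕ-++)
open import Data.Nat.Properties
open import Algebra.Properties.CommutativeSemigroup +-commutativeSemigroup using () renaming (interchange to +-interchange)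
open import Data.Product using (_,_; proj₁; proj₂; ∃; ∃₂)
open import Data.Rational as ℚ using (ℚ; 0ℚ; mkℚ; _/_; ↥_; ↧_; *≤*)
import Data.Rational.Properties as ℚ
open import Data.Rational.Solver using (module +-*-Solver)
import Data.Rational.Unnormalised as ℚᵘ
import Data.Rational.Unnormalised.Properties as ℚᵘ
open import Data.Sum using (_⊎_; inj₁; inj₂)
open import Data.Vec as Vec using ([]; _∷_; toList)
import Data.Vec.Properties as Vec
open import Function using (_∘_; id; _⇔_; mk⇔; Equivalence; Injective)
open import Function.Properties.Equivalence using () renaming (trans to ⇔-trans)
open import Level using (0ℓ)
open import Relation.Binary.Core using (Rel)
open import Relation.Binary.Definitions using (Irreflexive; Transitive; tri<; tri≈; tri>)
open import Relation.Binary.PropositionalEquality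
open import Relation.Nullary using (¬_; yes; no)
open import Relation.Nullary.Decidable using (⌊_⌋)
open import Relation.Unary using (Pred; Decidable)

-- Floors of rationals

fromℤ : ℤ → ℚ
fromℤ m = m / 1

↥-fromℤ : ∀ m → ↥ fromℤ m ≡ m
↥-fromℤ m = trans (sym (ℤ.*-identityʳ _))
  (trans (cong (λ g → ↥ fromℤ m ℤ.* + g) (sym (gcd-zeroʳ ℤ.∣ m ∣))) (ℚ.↥-/ m 1))

↧-fromℤ : ∀ m → ↧ fromℤ m ≡ + 1
↧-fromℤ m = trans (sym (ℤ.*-identityʳ _))
  (trans (cong (λ g → ↧ fromℤ m ℤ.* + g) (sym (gcd-zeroʳ ℤ.∣ m ∣))) (ℚ.↧-/ m 1))

*-↧-fromℤ : ∀ m k → k ℤ.* ↧ fromℤ m ≡ k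
*-↧-fromℤ m k = trans (cong (k ℤ.*_) (↧-fromℤ m)) (ℤ.*-identityʳ k)

↥-fromℤ-* : ∀ m k → ↥ fromℤ m ℤ.* k ≡ m ℤ.* k
↥-fromℤ-* m k = cong (ℤ._* k) (↥-fromℤ m)

fromℤ-+ : ∀ m n → fromℤ (m ℤ.+ n) ≡ fromℤ m ℚ.+ fromℤ n
fromℤ-+ m n = ℚ.toℚᵘ-injective (begin
    ℚ.toℚᵘ (fromℤ (m ℤ.+ n))                  ≈⟨ ℚ.toℚᵘ-fromℚᵘ (ℚᵘ.mkℚᵘ (m ℤ.+ n) 0) ⟩
    ℚᵘ.mkℚᵘ (m ℤ.+ n) 0                       ≈⟨ ℚᵘ.*≡* (normalise m n) ⟩
    ℚᵘ.mkℚᵘ m 0 ℚᵘ.+ ℚᵘ.mkℚᵘ n 0              ≈⟨ ℚᵘ.+-cong (ℚ.toℚᵘ-fromℚᵘ (ℚᵘ.mkℚᵘ m 0)) (ℚ.toℚᵘ-fromℚᵘ (ℚᵘ.mkℚᵘ n 0)) ⟨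
    ℚ.toℚᵘ (fromℤ m) ℚᵘ.+ ℚ.toℚᵘ (fromℤ n)    ≈⟨ ℚᵘ.≃-sym (ℚ.toℚᵘ-homo-+ (fromℤ m) (fromℤ n)) ⟩
    ℚ.toℚᵘ (fromℤ m ℚ.+ fromℤ n)              ∎)
  where
  open ℚᵘ.≃-Reasoning
  normalise : ∀ a b → (a ℤ.+ b) ℤ.* + 1 ≡ (a ℤ.* + 1 ℤ.+ b ℤ.* + 1) ℤ.* + 1
  normalise = solve-∀

module _ (n : ℤ) (e : ℕ) where

  *≤⇒≤/ : ∀ m → m ℤ.* + suc e ℤ.≤ n → m ℤ.≤ n ℤ./ + suc e
  *≤⇒≤/ m le = ℤ.≮⇒≥ λ q<m → ℤ.<-irrefl refl (ℤ.<-≤-trans n<[q+1]*D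
    (ℤ.≤-trans (ℤ.*-monoʳ-≤-nonNeg (+ suc e) (ℤ.i<j⇒suc[i]≤j q<m)) le))
    where
    n<[q+1]*D : n ℤ.< ℤ.suc (n ℤ./ + suc e) ℤ.* + suc e
    n<[q+1]*D = subst (λ q → n ℤ.< ℤ.suc q ℤ.* + suc e) (sym (ℤ.div-pos-is-/ℕ n (suc e))) (ℤ.n<s[n/ℕd]*d n (suc e))

  ≤/⇒*≤ : ∀ m → m ℤ.≤ n ℤ./ + suc e → m ℤ.* + suc e ℤ.≤ n
  ≤/⇒*≤ m le = ℤ.≤-trans (ℤ.*-monoʳ-≤-nonNeg (+ suc e) le) (ℤ.[n/d]*d≤n n (+ suc e))

fromℤ-≤⇒≤-floor : ∀ m x → fromℤ m ℚ.≤ x → m ℤ.≤ ℚ.floor x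
fromℤ-≤⇒≤-floor m x@(mkℚ n e _) (*≤* le) = *≤⇒≤/ n e m (subst₂ ℤ._≤_ (↥-fromℤ-* m _) (*-↧-fromℤ m n) le)

≤-floor⇒fromℤ-≤ : ∀ m x → m ℤ.≤ ℚ.floor x → fromℤ m ℚ.≤ x
≤-floor⇒fromℤ-≤ m x@(mkℚ n e _) le = *≤* (subst₂ ℤ._≤_ (sym (↥-fromℤ-* m _)) (sym (*-↧-fromℤ m n)) (≤/⇒*≤ n e m le))

fromℤ-floor-≤ : ∀ x → fromℤ (ℚ.floor x) ℚ.≤ x
fromℤ-floor-≤ x = ≤-floor⇒fromℤ-≤ _ x ℤ.≤-refl

i<i+1 : ∀ i → i ℤ.< i ℤ.+ + 1
i<i+1 i = subst (i ℤ.<_) (ℤ.+-comm (+ 1) i) (ℤ.suc[i]≤j⇒i<j ℤ.≤-refl)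

<-fromℤ-floor+1 : ∀ x → x ℚ.< fromℤ (ℚ.floor x ℤ.+ + 1)
<-fromℤ-floor+1 x = ℚ.≰⇒> λ le → ℤ.<-irrefl refl (ℤ.<-≤-trans (i<i+1 _) (fromℤ-≤⇒≤-floor _ x le))

floor-unique : ∀ m x → fromℤ m ℚ.≤ x → x ℚ.< fromℤ (m ℤ.+ + 1) → ℚ.floor x ≡ m
floor-unique m x m≤x x<m+1 = ℤ.≤-antisym
  (ℤ.≮⇒≥ λ m<⌊x⌋ → ℚ.<-irrefl refl (ℚ.<-≤-trans x<m+1
    (≤-floor⇒fromℤ-≤ (m ℤ.+ + 1) x (subst (ℤ._≤ ℚ.floor x) (ℤ.+-comm (+ 1) m) (ℤ.i<j⇒suc[i]≤j m<⌊x⌋)))))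
  (fromℤ-≤⇒≤-floor m x m≤x)

floor-mono : ∀ {x y} → x ℚ.≤ y → ℚ.floor x ℤ.≤ ℚ.floor y
floor-mono {x} {y} x≤y = fromℤ-≤⇒≤-floor _ y (ℚ.≤-trans (fromℤ-floor-≤ x) x≤y)

floor-fromℤ-+ : ∀ n x → ℚ.floor (fromℤ n ℚ.+ x) ≡ n ℤ.+ ℚ.floor x
floor-fromℤ-+ n x = floor-unique (n ℤ.+ ℚ.floor x) (fromℤ n ℚ.+ x)
  (subst (ℚ._≤ fromℤ n ℚ.+ x) (sym (fromℤ-+ n (ℚ.floor x))) (ℚ.+-monoʳ-≤ (fromℤ n) (fromℤ-floor-≤ x)))
  (subst (fromℤ n ℚ.+ x ℚ.<_) (trans (sym (fromℤ-+ n (ℚ.floor x ℤ.+ + 1))) (cong fromℤ (sym (ℤ.+-assoc n (ℚ.floor x) (+ 1)))))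
    (ℚ.+-monoʳ-< (fromℤ n) (<-fromℤ-floor+1 x)))

floor-+-≥ : ∀ x y → ℚ.floor x ℤ.+ ℚ.floor y ℤ.≤ ℚ.floor (x ℚ.+ y)
floor-+-≥ x y = fromℤ-≤⇒≤-floor _ (x ℚ.+ y)
  (subst (ℚ._≤ x ℚ.+ y) (sym (fromℤ-+ (ℚ.floor x) (ℚ.floor y))) (ℚ.+-mono-≤ (fromℤ-floor-≤ x) (fromℤ-floor-≤ y)))

floor-+-≤ : ∀ x y → ℚ.floor (x ℚ.+ y) ℤ.≤ ℚ.floor x ℤ.+ ℚ.floor y ℤ.+ + 1
floor-+-≤ x y = ℤ.≮⇒≥ λ lt → ℚ.<-irrefl refl (ℚ.<-≤-trans
  (subst (x ℚ.+ y ℚ.<_) (trans (sym (fromℤ-+ (ℚ.floor x ℤ.+ + 1) (ℚ.floor y ℤ.+ + 1))) (cong fromℤ (regroup (ℚ.floor x) (ℚ.floor y))))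
    (ℚ.+-mono-< (<-fromℤ-floor+1 x) (<-fromℤ-floor+1 y)))
  (≤-floor⇒fromℤ-≤ _ (x ℚ.+ y) (ℤ.i<j⇒suc[i]≤j lt)))
  where
  regroup : ∀ a b → (a ℤ.+ + 1) ℤ.+ (b ℤ.+ + 1) ≡ + 1 ℤ.+ (a ℤ.+ b ℤ.+ + 1)
  regroup = solve-∀

floor-+-sub-floor : ∀ y z → (ℚ.floor z ℤ.≤ ℚ.floor (y ℚ.+ z) ℤ.- ℚ.floor y) ×
                             (ℚ.floor (y ℚ.+ z) ℤ.- ℚ.floor y ℤ.≤ ℚ.floor z ℤ.+ + 1)
floor-+-sub-floor y z =
  subst (ℤ._≤ ℚ.floor (y ℚ.+ z) ℤ.- ℚ.floor y) (cancel (ℚ.floor y) (ℚ.floor z))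
    (ℤ.+-monoˡ-≤ (ℤ.- ℚ.floor y) (floor-+-≥ y z)) ,
  subst (ℚ.floor (y ℚ.+ z) ℤ.- ℚ.floor y ℤ.≤_) (cancel (ℚ.floor y) (ℚ.floor z ℤ.+ + 1))
    (ℤ.+-monoˡ-≤ (ℤ.- ℚ.floor y) (subst (ℚ.floor (y ℚ.+ z) ℤ.≤_) (ℤ.+-assoc (ℚ.floor y) (ℚ.floor z) (+ 1)) (floor-+-≤ y z)))
  where
  cancel : ∀ a b → a ℤ.+ b ℤ.- a ≡ b
  cancel = solve-∀

floors-cancel⇒integral : ∀ x y → x ℚ.+ y ≡ ℚ.0ℚ → ℚ.floor x ℤ.+ ℚ.floor y ≡ + 0 → x ≡ fromℤ (ℚ.floor x)
floors-cancel⇒integral x y x+y≡0 ⌊x⌋+⌊y⌋≡0 = ℚ.≤-antisym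
  (ℚ.≮⇒≥ λ ⌊x⌋<x → ℚ.<-irrefl refl
    (subst₂ ℚ._<_ (trans (sym (fromℤ-+ (ℚ.floor x) (ℚ.floor y))) (cong fromℤ ⌊x⌋+⌊y⌋≡0)) x+y≡0
      (ℚ.+-mono-<-≤ ⌊x⌋<x (fromℤ-floor-≤ y))))
  (fromℤ-floor-≤ x)

-- Finite sums

∑< : ℕ → (ℕ → ℕ) → ℕ
∑< zero    f = 0
∑< (suc n) f = f 0 + ∑< n (f ∘ suc)

∑<-cong : ∀ n {f g} → (∀ i → i < n → f i ≡ g i) → ∑< n f ≡ ∑< n g
∑<-cong zero    f≡g = refl
∑<-cong (suc n) f≡g = cong₂ _+_ (f≡g 0 (s≤s z≤n)) (∑<-cong n (λ i i<n → f≡g (suc i) (s≤s i<n)))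

∑<-mono-≤ : ∀ n {f g} → (∀ i → i < n → f i ≤ g i) → ∑< n f ≤ ∑< n g
∑<-mono-≤ zero    f≤g = z≤n
∑<-mono-≤ (suc n) f≤g = +-mono-≤ (f≤g 0 (s≤s z≤n)) (∑<-mono-≤ n (λ i i<n → f≤g (suc i) (s≤s i<n)))

∑<-distrib-+ : ∀ n f g → ∑< n (λ i → f i + g i) ≡ ∑< n f + ∑< n g
∑<-distrib-+ zero    f g = refl
∑<-distrib-+ (suc n) f g =
  trans (cong (_+_ (f 0 + g 0)) (∑<-distrib-+ n (f ∘ suc) (g ∘ suc))) (+-interchange (f 0) (g 0) _ _)

∑<-const : ∀ n k → ∑< n (λ _ → k) ≡ n * k
∑<-const zero    k = refl
∑<-const (suc n) k = cong (_+_ k) (∑<-const n k)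

∑<-const-1 : ∀ n → ∑< n (λ _ → 1) ≡ n
∑<-const-1 n = trans (∑<-const n 1) (*-identityʳ n)

∑<-snoc : ∀ n f → ∑< (suc n) f ≡ ∑< n f + f n
∑<-snoc zero    f = +-comm (f 0) 0
∑<-snoc (suc n) f = trans (cong (_+_ (f 0)) (∑<-snoc n (f ∘ suc))) (sym (+-assoc (f 0) _ _))

∑<-term : ∀ n f {i} → i < n → f i ≤ ∑< n f
∑<-term (suc n) f {zero}  _         = m≤m+n (f 0) _
∑<-term (suc n) f {suc i} (s≤s i<n) = ≤-trans (∑<-term n (f ∘ suc) i<n) (m≤n+m _ (f 0))

∑<-two : ∀ n f {i j} → i < n → j < n → i ≢ j → f i + f j ≤ ∑< n f
∑<-two (suc n) f {zero}  {zero}  _         _         0≢0 = ⊥-elim (0≢0 refl)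
∑<-two (suc n) f {zero}  {suc j} _         (s≤s j<n) _   = +-monoʳ-≤ (f 0) (∑<-term n (f ∘ suc) j<n)
∑<-two (suc n) f {suc i} {zero}  (s≤s i<n) _         _   =
  subst (_≤ ∑< (suc n) f) (+-comm (f 0) (f (suc i))) (+-monoʳ-≤ (f 0) (∑<-term n (f ∘ suc) i<n))
∑<-two (suc n) f {suc i} {suc j} (s≤s i<n) (s≤s j<n) i≢j =
  ≤-trans (∑<-two n (f ∘ suc) i<n j<n (i≢j ∘ cong suc)) (m≤n+m _ (f 0))

∑<-≤-length : ∀ n {f} → (∀ i → i < n → f i ≤ 1) → ∑< n f ≤ n
∑<-≤-length n {f} f≤1 = subst (∑< n f ≤_) (∑<-const-1 n) (∑<-mono-≤ n f≤1)

∑<-≤-pointwise-≡ : ∀ n {f g} → (∀ i → i < n → f i ≤ g i) → ∑< n g ≤ ∑< n f → ∀ i → i < n → f i ≡ g i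
∑<-≤-pointwise-≡ (suc n) {f} {g} f≤g Σg≤Σf i i<1+n = go i i<1+n
  where
  F = ∑< n (f ∘ suc)
  G = ∑< n (g ∘ suc)
  F≤G : F ≤ G
  F≤G = ∑<-mono-≤ n (λ i i<n → f≤g (suc i) (s≤s i<n))
  go : ∀ i → i < suc n → f i ≡ g i
  go zero    _         = ≤-antisym (f≤g 0 (s≤s z≤n)) (+-cancelʳ-≤ G (g 0) (f 0) (≤-trans Σg≤Σf (+-monoʳ-≤ (f 0) F≤G)))
  go (suc i) (s≤s i<n) = ∑<-≤-pointwise-≡ n (λ i i<n → f≤g (suc i) (s≤s i<n))
    (+-cancelˡ-≤ (g 0) G F (≤-trans Σg≤Σf (+-monoˡ-≤ F (f≤g 0 (s≤s z≤n))))) i i<n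

∑<-nonzero : ∀ n f → ∑< n f ≢ 0 → ∃ λ i → i < n × f i ≢ 0
∑<-nonzero zero    f Σ≢0 = ⊥-elim (Σ≢0 refl)
∑<-nonzero (suc n) f Σ≢0 with f 0 ≟ 0
... | no  f0≢0 = 0 , s≤s z≤n , f0≢0
... | yes f0≡0 with ∑<-nonzero n (f ∘ suc) (λ Σ≡0 → Σ≢0 (cong₂ _+_ f0≡0 Σ≡0))
...   | i , i<n , fi≢0 = suc i , s≤s i<n , fi≢0

antitone-01-∑< : ∀ n g → (∀ i → suc i < n → g (suc i) ≤ g i) → (∀ i → i < n → g i ≤ 1) →
                 ∀ i → i < n → (g i ≡ 1 ⇔ i < ∑< n g)
antitone-01-∑< (suc n) g anti g≤1 i i<1+n = by-head (g 0) refl (g≤1 0 (s≤s z≤n))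
  where
  tail : ∀ i → i < n → (g (suc i) ≡ 1 ⇔ i < ∑< n (g ∘ suc))
  tail = antitone-01-∑< n (g ∘ suc) (λ i si<n → anti (suc i) (s≤s si<n)) (λ i i<n → g≤1 (suc i) (s≤s i<n))

  tail-empty : g 0 ≡ 0 → ¬ (0 < ∑< n (g ∘ suc))
  tail-empty g0≡0 0<Σ with ∑<-nonzero n (g ∘ suc) (>⇒≢ 0<Σ)
  ... | _ , i<n , _ = 1+n≰n (subst (1 ≤_) g0≡0
         (subst (_≤ g 0) (Equivalence.from (tail 0 0<n) 0<Σ) (anti 0 (s≤s 0<n))))
    where
    0<n = ≤-trans (s≤s z≤n) i<n

  by-head : ∀ v → g 0 ≡ v → v ≤ 1 → (g i ≡ 1 ⇔ i < v + ∑< n (g ∘ suc))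
  by-head 1 g0≡1 _ = head-one i i<1+n
    where
    head-one : ∀ i → i < suc n → (g i ≡ 1 ⇔ i < suc (∑< n (g ∘ suc)))
    head-one zero    _         = mk⇔ (λ _ → s≤s z≤n) (λ _ → g0≡1)
    head-one (suc i) (s≤s i<n) = mk⇔ (s≤s ∘ Equivalence.to (tail i i<n)) (Equivalence.from (tail i i<n) ∘ s≤s⁻¹)
  by-head 0 g0≡0 _ = mk⇔ (to i i<1+n) (⊥-elim ∘ tail-empty g0≡0 ∘ <-≤-trans (s≤s z≤n))
    where
    to : ∀ i → i < suc n → g i ≡ 1 → i < ∑< n (g ∘ suc)
    to zero    _         gi≡1 = ⊥-elim (0≢1+n (trans (sym g0≡0) gi≡1))
    to (suc i) (s≤s i<n) gi≡1 = ⊥-elim (tail-empty g0≡0 (<-≤-trans (s≤s z≤n) (Equivalence.to (tail i i<n) gi≡1)))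
  by-head (suc (suc _)) _ (s≤s ())

∑<-tabulate : ∀ n g → Vec.sum (Vec.tabulate {n = n} (g ∘ toℕ)) ≡ ∑< n g
∑<-tabulate zero    g = refl
∑<-tabulate (suc n) g = cong (_+_ (g 0)) (∑<-tabulate n (g ∘ suc))

-- Lists and vectors

take-split : ∀ {A : Set} (xs : List A) {a b} → a ≤ b → take b xs ≡ take a xs ++ take (b ∸ a) (drop a xs)
take-split xs        {zero}          _         = refl
take-split []        {suc a} {suc b} _         = sym (take-[] (b ∸ a))
take-split (x ∷ xs)  {suc a} {suc b} (s≤s a≤b) = cong (x ∷_) (take-split xs a≤b)

sum-toList : ∀ {n} (v : Vec ℕ n) → Vec.sum v ≡ sumℕ (toList v)
sum-toList []      = refl
sum-toList (x ∷ v) = cong (_+_ x) (sum-toList v)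

sum-take≤sum : ∀ xs t → sumℕ (take t xs) ≤ sumℕ xs
sum-take≤sum xs t = subst (sumℕ (take t xs) ≤_) (trans (sym (sumℕ-++ (take t xs) (drop t xs))) (cong sumℕ (take++drop≡id t xs)))
  (m≤m+n _ _)

sum-take-mono : ∀ xs {t t′} → t ≤ t′ → sumℕ (take t xs) ≤ sumℕ (take t′ xs)
sum-take-mono xs {t} {t′} t≤t′ = subst (_≤ sumℕ (take t′ xs))
  (cong sumℕ (trans (take-take t t′ xs) (cong (λ k → take k xs) (m≤n⇒m⊓n≡m t≤t′))))
  (sum-take≤sum (take t′ xs) t)

sum-take-injective : ∀ {n} (u v : Vec ℕ n) → (∀ t → sumℕ (take t (toList u)) ≡ sumℕ (take t (toList v))) → u ≡ v
sum-take-injective []      []      _      = refl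
sum-take-injective (x ∷ u) (y ∷ v) prefix≡ = cong₂ _∷_ x≡y
  (sum-take-injective u v λ t → +-cancelˡ-≡ x _ _ (trans (prefix≡ (suc t)) (cong (_+ _) (sym x≡y))))
  where
  x≡y : x ≡ y
  x≡y = trans (sym (+-identityʳ x)) (trans (prefix≡ 1) (+-identityʳ y))

sum-take-lookup : ∀ {n} (v : Vec ℕ n) (k : Fin n) →
                  sumℕ (take (toℕ k) (toList v)) + Vec.lookup v k ≡ sumℕ (take (suc (toℕ k)) (toList v))
sum-take-lookup (x ∷ v) Fin.zero    = +-comm 0 x
sum-take-lookup (x ∷ v) (Fin.suc k) = trans (+-assoc x _ _) (cong (_+_ x) (sum-take-lookup v k))

lookup≤sum : ∀ {n} (v : Vec ℕ n) k → Vec.lookup v k ≤ Vec.sum v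
lookup≤sum (x ∷ v) Fin.zero    = m≤m+n x _
lookup≤sum (x ∷ v) (Fin.suc k) = ≤-trans (lookup≤sum v k) (m≤n+m _ x)

foldr-⊓-attained : ∀ {I : Set} (h : I → ℕ) {z m} xs → m ≤ z → (∀ i → m ≤ h i) → ∃ (λ i → i ∈ xs × h i ≡ m) →
                   List.foldr (λ i x → h i ⊓ x) z xs ≡ m
foldr-⊓-attained h xs m≤z m≤h (i , i∈xs , hi≡m) = ≤-antisym (≤-trans (upper xs i∈xs) (≤-reflexive hi≡m)) (lower xs)
  where
  lower : ∀ xs → _ ≤ List.foldr (λ i x → h i ⊓ x) _ xs
  lower []       = m≤z
  lower (j ∷ xs) = ⊓-glb (m≤h j) (lower xs)
  upper : ∀ xs → i ∈ xs → List.foldr (λ i x → h i ⊓ x) _ xs ≤ h i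
  upper (j ∷ xs) (here refl) = m⊓n≤m (h j) _
  upper (j ∷ xs) (there i∈) = ≤-trans (m⊓n≤n (h j) _) (upper xs i∈)

concat-map-if≡map-filter : ∀ {A B : Set} {P Q : Pred A 0ℓ} (P? : Decidable P) (Q? : Decidable Q) (f : A → B) {xs} →
  All (λ x → P x ⇔ Q x) xs → concat (List.map (λ x → if ⌊ P? x ⌋ then f x ∷ [] else []) xs) ≡ List.map f (filter Q? xs)
concat-map-if≡map-filter P? Q? f {[]} [] = refl
concat-map-if≡map-filter P? Q? f {x ∷ xs} (P⇔Q ∷ rest) with P? x | Q? x
... | yes _  | yes _  = cong (f x ∷_) (concat-map-if≡map-filter P? Q? f rest)
... | no  _  | no  _  = concat-map-if≡map-filter P? Q? f rest
... | yes Px | no ¬Qx = ⊥-elim (¬Qx (Equivalence.to P⇔Q Px))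
... | no ¬Px | yes Qx = ⊥-elim (¬Px (Equivalence.from P⇔Q Qx))

AllPairs-restrict : ∀ {A : Set} {P : Pred A 0ℓ} {R S : Rel A 0ℓ} → (∀ {x y} → P x → P y → R x y → S x y) →
                    ∀ {xs} → All P xs → AllPairs R xs → AllPairs S xs
AllPairs-restrict R⇒S []         []           = []
AllPairs-restrict R⇒S (Px ∷ Pxs) (Rx ∷ Rxs) = All.zipWith (λ (Py , Rxy) → R⇒S Px Py Rxy) (Pxs , Rx) ∷ AllPairs-restrict R⇒S Pxs Rxs

sorted-same-elements⇒≡ : ∀ {A : Set} {R : Rel A 0ℓ} → Irreflexive _≡_ R → Transitive R → ∀ {xs ys} →
  AllPairs R xs → AllPairs R ys → (∀ {z} → z ∈ xs → z ∈ ys) → (∀ {z} → z ∈ ys → z ∈ xs) → xs ≡ ys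
sorted-same-elements⇒≡ irr tr {[]}     {[]}     _ _ _ _ = refl
sorted-same-elements⇒≡ irr tr {[]}     {y ∷ ys} _ _ _ ys⊆ with () ← ys⊆ (here refl)
sorted-same-elements⇒≡ irr tr {x ∷ xs} {[]}     _ _ xs⊆ _ with () ← xs⊆ (here refl)
sorted-same-elements⇒≡ {R = R} irr tr {x ∷ xs} {y ∷ ys} (x<xs ∷ xs↗) (y<ys ∷ ys↗) xs⊆ ys⊆ =
  cong₂ _∷_ x≡y (sorted-same-elements⇒≡ irr tr xs↗ ys↗ xs⊆′ ys⊆′)
  where
  x≡y : x ≡ y
  x≡y with xs⊆ (here refl) | ys⊆ (here refl)
  ... | here x≡y   | _          = x≡y
  ... | there _    | here y≡x   = sym y≡x
  ... | there x∈ys | there y∈xs = ⊥-elim (irr refl (tr (All.lookup y<ys x∈ys) (All.lookup x<xs y∈xs)))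
  xs⊆′ : ∀ {z} → z ∈ xs → z ∈ ys
  xs⊆′ z∈xs with xs⊆ (there z∈xs)
  ... | here refl = ⊥-elim (irr refl (subst (λ w → R w _) x≡y (All.lookup x<xs z∈xs)))
  ... | there z∈ys = z∈ys
  ys⊆′ : ∀ {z} → z ∈ ys → z ∈ xs
  ys⊆′ z∈ys with ys⊆ (there z∈ys)
  ... | here refl = ⊥-elim (irr refl (subst (λ w → R w _) (sym x≡y) (All.lookup y<ys z∈ys)))
  ... | there z∈xs = z∈xs

upTo-↗ : ∀ n → AllPairs _<_ (upTo n)
upTo-↗ n = AllPairs.applyUpTo⁺₁ id n (λ i<j _ → i<j)

map-upTo-↭ : ∀ n g → (∀ {i} → i < n → g i < n) → (∀ {i j} → i < n → j < n → g i ≡ g j → i ≡ j) →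
             (∀ {j} → j < n → ∃ λ i → i < n × g i ≡ j) → List.map g (upTo n) ↭ upTo n
map-upTo-↭ n g g<n g-inj g-surj = ∼bag⇒↭ (unique∧set⇒bag g-unique upTo-unique (mk⇔ to from))
  where
  g-unique : AllPairs (λ x y → ¬ x ≡ y) (List.map g (upTo n))
  g-unique = AllPairs.map⁺ (AllPairs.applyUpTo⁺₁ id n (λ i<j j<n gi≡gj → <-irrefl (g-inj (<-trans i<j j<n) j<n gi≡gj) i<j))
  upTo-unique : AllPairs (λ x y → ¬ x ≡ y) (upTo n)
  upTo-unique = AllPairs.map (λ i<j i≡j → <-irrefl i≡j i<j) (upTo-↗ n)
  to : ∀ {z} → z ∈ List.map g (upTo n) → z ∈ upTo n
  to z∈ with i , i∈ , refl ← ∈.∈-map⁻ g z∈ = ∈.∈-upTo⁺ (g<n (∈.∈-upTo⁻ i∈))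
  from : ∀ {z} → z ∈ upTo n → z ∈ List.map g (upTo n)
  from z∈ with i , i<n , refl ← g-surj (∈.∈-upTo⁻ z∈) = ∈.∈-map⁺ g (∈.∈-upTo⁺ i<n)

injective⇒surjective : ∀ {n} (h : Fin (suc n) → Fin (suc n)) → Injective _≡_ _≡_ h → ∀ i → ∃ λ k → h k ≡ i
injective⇒surjective h h-inj i with Fin.any? (λ k → h k Fin.≟ i)
... | yes hit  = hit
... | no  miss = collision (Fin.pigeonhole (n<1+n _) (λ k → Fin.punchOut (i≢h k)))
  where
  i≢h : ∀ k → i ≢ h k
  i≢h k i≡hk = miss (k , sym i≡hk)
  collision : (∃₂ λ k k′ → k Fin.< k′ × Fin.punchOut (i≢h k) ≡ Fin.punchOut (i≢h k′)) → ∃ λ k → h k ≡ i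
  collision (k , k′ , k<k′ , eq) = ⊥-elim (Fin.<⇒≢ k<k′ (h-inj (Fin.punchOut-injective (i≢h k) (i≢h k′) eq)))

descent : (ℕ → ℕ) → ℕ → ℕ
descent g t = if ⌊ g (suc t) <? g t ⌋ then 1 else 0

descent-yes : ∀ g {t} → g (suc t) < g t → descent g t ≡ 1
descent-yes g {t} lt with g (suc t) <? g t
... | yes _  = refl
... | no ¬lt = ⊥-elim (¬lt lt)

descent-no : ∀ g {t} → ¬ g (suc t) < g t → descent g t ≡ 0
descent-no g {t} ¬lt with g (suc t) <? g t
... | yes lt = ⊥-elim (¬lt lt)
... | no _   = refl

descent≤1 : ∀ g t → descent g t ≤ 1
descent≤1 g t with g (suc t) <? g t
... | yes _ = s≤s z≤n
... | no  _ = z≤n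

des-applyUpTo : ∀ g n → des (applyUpTo g (suc n)) ≡ ∑< n (descent g)
des-applyUpTo g zero    = refl
des-applyUpTo g (suc n) = cong (_+_ (descent g 0)) (des-applyUpTo (g ∘ suc) n)

-- Multisets as sorted lists

ms : ℕ → List ℕ → List ℕ
ms k []       = []
ms k (n ∷ xs) = replicate n k ++ ms (suc k) xs

multiset≡ms : ∀ {n} (x : Vec ℕ n) → multiset x ≡ ms 1 (toList x)
multiset≡ms x = trans (cong concat (map-tabulate id (λ t → replicate (Vec.lookup x t) (suc (toℕ t))))) (go x 1 (λ _ → refl))
  where
  go : ∀ {n} (x : Vec ℕ n) {f : Fin n → ℕ} k → (∀ t → f t ≡ k + toℕ t) →
       concat (tabulate (λ t → replicate (Vec.lookup x t) (f t))) ≡ ms k (toList x)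
  go []      k f≡ = refl
  go (y ∷ x) k f≡ = cong₂ _++_ (cong (replicate y) (trans (f≡ Fin.zero) (+-identityʳ k)))
                               (go x (suc k) (λ t → trans (f≡ (Fin.suc t)) (+-suc k (toℕ t))))

nth-++ˡ : ∀ xs ys {c} → c < List.length xs → nth (xs ++ ys) c ≡ nth xs c
nth-++ˡ (x ∷ xs) ys {zero}  _         = refl
nth-++ˡ (x ∷ xs) ys {suc c} (s≤s c<n) = nth-++ˡ xs ys c<n

nth-++ʳ : ∀ xs ys c → nth (xs ++ ys) (List.length xs + c) ≡ nth ys c
nth-++ʳ []       ys c = refl
nth-++ʳ (x ∷ xs) ys c = nth-++ʳ xs ys c

nth-replicate : ∀ n k {c} → c < n → nth (replicate n k) c ≡ k
nth-replicate (suc n) k {zero}  _         = refl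
nth-replicate (suc n) k {suc c} (s≤s c<n) = nth-replicate n k c<n

nth-ms-head : ∀ {n} k xs {c} → c < n → nth (ms k (n ∷ xs)) c ≡ k
nth-ms-head {n} k xs c<n =
  trans (nth-++ˡ (replicate n k) (ms (suc k) xs) (subst (_ <_) (sym (length-replicate n)) c<n)) (nth-replicate n k c<n)

nth-ms-tail : ∀ {n} k xs {c} → n ≤ c → nth (ms k (n ∷ xs)) c ≡ nth (ms (suc k) xs) (c ∸ n)
nth-ms-tail {n} k xs {c} n≤c = trans (cong (nth (ms k (n ∷ xs))) (sym c≡)) (nth-++ʳ (replicate n k) (ms (suc k) xs) (c ∸ n))
  where
  c≡ : List.length (replicate n k) + (c ∸ n) ≡ c
  c≡ = trans (cong (_+ (c ∸ n)) (length-replicate n)) (m+[n∸m]≡n n≤c)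

∸-<⇔<-+ : ∀ {n c m} → n ≤ c → (c ∸ n < m ⇔ c < n + m)
∸-<⇔<-+ {n} {c} {m} n≤c = mk⇔
  (λ lt → subst (_< n + m) (m+[n∸m]≡n n≤c) (+-monoʳ-< n lt))
  (λ lt → +-cancelˡ-< n (c ∸ n) m (subst (_< n + m) (sym (m+[n∸m]≡n n≤c)) lt))

ms-entry-≥ : ∀ k xs {c} → c < sumℕ xs → k ≤ nth (ms k xs) c
ms-entry-≥ k (n ∷ xs) {c} c<Σ with c <? n
... | yes c<n = ≤-reflexive (sym (nth-ms-head k xs c<n))
... | no  c≮n = subst (k ≤_) (sym (nth-ms-tail k xs (≮⇒≥ c≮n)))
  (≤-trans (n≤1+n k) (ms-entry-≥ (suc k) xs (Equivalence.from (∸-<⇔<-+ (≮⇒≥ c≮n)) c<Σ)))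

ms-entry-≤⇔ : ∀ k xs {c} t → c < sumℕ xs → (nth (ms k xs) c ≤ k + t ⇔ c < sumℕ (take (suc t) xs))
ms-entry-≤⇔ k (n ∷ xs) {c} t c<Σ with c <? n
... | yes c<n = mk⇔ (λ _ → ≤-trans c<n (m≤m+n n _)) (λ _ → subst (_≤ k + t) (sym (nth-ms-head k xs c<n)) (m≤m+n k t))
... | no  c≮n = subst (λ e → (e ≤ k + t) ⇔ (c < n + sumℕ (take t xs))) (sym (nth-ms-tail k xs n≤c)) (beyond-head t)
  where
  n≤c = ≮⇒≥ c≮n
  c∸n<Σ = Equivalence.from (∸-<⇔<-+ n≤c) c<Σ
  beyond-head : ∀ t → (nth (ms (suc k) xs) (c ∸ n) ≤ k + t ⇔ c < n + sumℕ (take t xs))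
  beyond-head zero     = mk⇔ (λ le → ⊥-elim (1+n≰n (≤-trans (ms-entry-≥ (suc k) xs c∸n<Σ)
                                                              (subst (nth (ms (suc k) xs) (c ∸ n) ≤_) (+-identityʳ k) le))))
                             (λ lt → ⊥-elim (c≮n (subst (c <_) (+-identityʳ n) lt)))
  beyond-head (suc t′) = subst (λ m → (nth (ms (suc k) xs) (c ∸ n) ≤ m) ⇔ (c < n + sumℕ (take (suc t′) xs))) (sym (+-suc k t′))
                           (⇔-trans (ms-entry-≤⇔ (suc k) xs t′ c∸n<Σ) (∸-<⇔<-+ n≤c))

ms-entry-<⇔gap : ∀ xs ys {c} → c < sumℕ xs → c < sumℕ ys →
  (nth (ms 1 xs) c < nth (ms 1 ys) c ⇔ ∃ λ t → sumℕ (take (suc t) ys) ≤ c × c < sumℕ (take (suc t) xs))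
ms-entry-<⇔gap xs ys {c} c<Σxs c<Σys = mk⇔ to from
  where
  to : nth (ms 1 xs) c < nth (ms 1 ys) c → ∃ λ t → sumℕ (take (suc t) ys) ≤ c × c < sumℕ (take (suc t) xs)
  to lt with nth (ms 1 xs) c in eq | ms-entry-≥ 1 xs c<Σxs
  ... | suc t | _ = t , ≮⇒≥ (λ c<ys → <⇒≱ lt (Equivalence.from (ms-entry-≤⇔ 1 ys t c<Σys) c<ys))
                      , Equivalence.to (ms-entry-≤⇔ 1 xs t c<Σxs) (≤-reflexive eq)
  from : (∃ λ t → sumℕ (take (suc t) ys) ≤ c × c < sumℕ (take (suc t) xs)) → nth (ms 1 xs) c < nth (ms 1 ys) c
  from (t , ys≤c , c<xs) = ≤-<-trans (Equivalence.from (ms-entry-≤⇔ 1 xs t c<Σxs) c<xs)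
    (≰⇒> λ le → <⇒≱ (Equivalence.to (ms-entry-≤⇔ 1 ys t c<Σys) le) ys≤c)

ms-≤⇒sum-take-≥ : ∀ xs ys → sumℕ xs ≡ sumℕ ys → (∀ c → c < sumℕ xs → nth (ms 1 xs) c ≤ nth (ms 1 ys) c) →
                  ∀ t → sumℕ (take t ys) ≤ sumℕ (take t xs)
ms-≤⇒sum-take-≥ xs ys Σ≡ entry≤ zero    = z≤n
ms-≤⇒sum-take-≥ xs ys Σ≡ entry≤ (suc t) = ≮⇒≥ λ c<ys → <-irrefl refl
  (Equivalence.to (ms-entry-≤⇔ 1 xs t (c<Σ c<ys)) (≤-trans (entry≤ c (c<Σ c<ys))
    (Equivalence.from (ms-entry-≤⇔ 1 ys t (subst (c <_) Σ≡ (c<Σ c<ys))) c<ys)))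
  where
  c = sumℕ (take (suc t) xs)
  c<Σ : c < sumℕ (take (suc t) ys) → c < sumℕ xs
  c<Σ c<ys = <-≤-trans c<ys (subst (sumℕ (take (suc t) ys) ≤_) (sym Σ≡) (sum-take≤sum ys (suc t)))

-- Rounding an interior point to lattice points

qsum : List ℚ → ℚ
qsum = foldr ℚ._+_ 0ℚ

qsum-++ : ∀ xs ys → qsum (xs ++ ys) ≡ qsum xs ℚ.+ qsum ys
qsum-++ []       ys = sym (ℚ.+-identityˡ (qsum ys))
qsum-++ (x ∷ xs) ys = trans (cong (x ℚ.+_) (qsum-++ xs ys)) (sym (ℚ.+-assoc x (qsum xs) (qsum ys)))

qsum-nonneg : ∀ {xs} → All (0ℚ ℚ.≤_) xs → 0ℚ ℚ.≤ qsum xs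
qsum-nonneg []         = ℚ.≤-refl
qsum-nonneg (0≤x ∷ 0≤xs) = ℚ.+-mono-≤ 0≤x (qsum-nonneg 0≤xs)

differences : (n : ℕ) → (ℕ → ℤ) → Vec ℕ n
differences zero    f = []
differences (suc n) f = ℤ.∣ f 1 ℤ.- f 0 ∣ ∷ differences n (f ∘ suc)

sum-take-differences : ∀ n f → (∀ i → f i ℤ.≤ f (suc i)) →
                       ∀ c → c ≤ n → + sumℕ (take c (toList (differences n f))) ≡ f c ℤ.- f 0
sum-take-differences n       f mono zero    _         = sym (ℤ.+-inverseʳ (f 0))
sum-take-differences (suc n) f mono (suc c) (s≤s c≤n) = begin
  + (ℤ.∣ f 1 ℤ.- f 0 ∣ ℕ.+ sumℕ (take c (toList (differences n (f ∘ suc)))))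
    ≡⟨ ℤ.pos-+ ℤ.∣ f 1 ℤ.- f 0 ∣ _ ⟩
  + ℤ.∣ f 1 ℤ.- f 0 ∣ ℤ.+ + sumℕ (take c (toList (differences n (f ∘ suc))))
    ≡⟨ cong₂ ℤ._+_ (ℤ.0≤i⇒+∣i∣≡i (ℤ.i≤j⇒0≤j-i (mono 0))) (sum-take-differences n (f ∘ suc) (mono ∘ suc) c c≤n) ⟩
  (f 1 ℤ.- f 0) ℤ.+ (f (suc c) ℤ.- f 1)
    ≡⟨ telescope (f 0) (f 1) (f (suc c)) ⟩
  f (suc c) ℤ.- f 0 ∎
  where
  open ≡-Reasoning
  telescope : ∀ a b c → (b ℤ.- a) ℤ.+ (c ℤ.- b) ≡ c ℤ.- a
  telescope = solve-∀

psum-differences : ∀ n f → (∀ i → f i ℤ.≤ f (suc i)) →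
                   ∀ {a b} → a ≤ b → b ≤ n → + psumℕ (differences n f) a b ≡ f b ℤ.- f a
psum-differences n f mono {a} {b} a≤b b≤n = begin
  + psumℕ (differences n f) a b
    ≡⟨ add-sub (+ S a) (+ psumℕ (differences n f) a b) ⟨
  (+ S a ℤ.+ + psumℕ (differences n f) a b) ℤ.- + S a
    ≡⟨ cong (ℤ._- + S a) (trans (sym (ℤ.pos-+ (S a) _)) (cong +_ S-split)) ⟩
  + S b ℤ.- + S a
    ≡⟨ cong₂ ℤ._-_ (sum-take-differences n f mono b b≤n) (sum-take-differences n f mono a (≤-trans a≤b b≤n)) ⟩
  (f b ℤ.- f 0) ℤ.- (f a ℤ.- f 0)
    ≡⟨ sub-sub (f a) (f b) (f 0) ⟩
  f b ℤ.- f a ∎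
  where
  open ≡-Reasoning
  xs = toList (differences n f)
  S : ℕ → ℕ
  S c = sumℕ (take c xs)
  S-split : S a ℕ.+ psumℕ (differences n f) a b ≡ S b
  S-split = sym (trans (cong sumℕ (take-split xs a≤b)) (sumℕ-++ (take a xs) _))
  add-sub : ∀ u v → (u ℤ.+ v) ℤ.- u ≡ v
  add-sub = solve-∀
  sub-sub : ∀ u v w → (v ℤ.- w) ℤ.- (u ℤ.- w) ≡ v ℤ.- u
  sub-sub = solve-∀

module Rounding {n} (p : Vec ℚ n) (p>0 : ∀ k → 0ℚ ℚ.< Vec.lookup p k) where

  P : ℕ → ℚ
  P b = qsum (take b (toList p))

  P-+-psum : ∀ {a b} → a ≤ b → P a ℚ.+ psumℚ p a b ≡ P b
  P-+-psum {a} {b} a≤b = sym (trans (cong qsum (take-split (toList p) a≤b)) (qsum-++ (take a (toList p)) _))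

  P-mono : ∀ {a b} → a ≤ b → P a ℚ.≤ P b
  P-mono {a} {b} a≤b = subst (P a ℚ.≤_) (P-+-psum a≤b)
    (subst (ℚ._≤ P a ℚ.+ psumℚ p a b) (ℚ.+-identityʳ (P a))
      (ℚ.+-monoʳ-≤ (P a) (qsum-nonneg (All.take⁺ (b ∸ a) (All.drop⁺ a (p≥0 p p>0))))))
    where
    p≥0 : ∀ {m} (q : Vec ℚ m) → (∀ k → 0ℚ ℚ.< Vec.lookup q k) → All (0ℚ ℚ.≤_) (toList q)
    p≥0 []      _   = []
    p≥0 (x ∷ q) q>0 = ℚ.<⇒≤ (q>0 Fin.zero) ∷ p≥0 q (q>0 ∘ Fin.suc)

  floor-P+θ-mono : ∀ θ i → ℚ.floor (P i ℚ.+ θ) ℤ.≤ ℚ.floor (P (suc i) ℚ.+ θ)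
  floor-P+θ-mono θ i = floor-mono (ℚ.+-monoˡ-≤ θ (P-mono (n≤1+n i)))

  round : ℚ → Vec ℕ n
  round θ = differences n (λ c → ℚ.floor (P c ℚ.+ θ))

  psum-round : ∀ θ {a b} → a ≤ b → b ≤ n → + psumℕ (round θ) a b ≡ ℚ.floor (P b ℚ.+ θ) ℤ.- ℚ.floor (P a ℚ.+ θ)
  psum-round θ = psum-differences n _ (floor-P+θ-mono θ)

  round-inClosure : ∀ θ {a b} → a < b → b ≤ n →
    (ℚ.floor (psumℚ p a b) ℤ.≤ + psumℕ (round θ) a b) × (+ psumℕ (round θ) a b ℤ.≤ ℚ.floor (psumℚ p a b) ℤ.+ + 1)
  round-inClosure θ {a} {b} a<b b≤n =
    subst (λ k → (ℚ.floor z ℤ.≤ k) × (k ℤ.≤ ℚ.floor z ℤ.+ + 1)) (sym psum≡) (floor-+-sub-floor (P a ℚ.+ θ) z)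
    where
    z = psumℚ p a b
    open +-*-Solver
    P+θ≡ : P b ℚ.+ θ ≡ (P a ℚ.+ θ) ℚ.+ psumℚ p a b
    P+θ≡ = trans (cong (ℚ._+ θ) (sym (P-+-psum (<⇒≤ a<b))))
                 (solve 3 (λ x z θ → (x :+ z) :+ θ := (x :+ θ) :+ z) refl (P a) z θ)
    psum≡ : + psumℕ (round θ) a b ≡ ℚ.floor ((P a ℚ.+ θ) ℚ.+ z) ℤ.- ℚ.floor (P a ℚ.+ θ)
    psum≡ = trans (psum-round θ (<⇒≤ a<b) b≤n) (cong (λ y → ℚ.floor y ℤ.- ℚ.floor (P a ℚ.+ θ)) P+θ≡)

  round-sum : ∀ θ r → P n ≡ fromℤ (+ r) → Vec.sum (round θ) ≡ r
  round-sum θ r Pn≡r = ℤ.+-injective (begin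
    + Vec.sum (round θ)                           ≡⟨ cong +_ (trans (sum-toList (round θ)) (cong sumℕ (sym take-length))) ⟩
    + sumℕ (take n (toList (round θ)))            ≡⟨ sum-take-differences n _ (floor-P+θ-mono θ) n ≤-refl ⟩
    ℚ.floor (P n ℚ.+ θ) ℤ.- ℚ.floor (0ℚ ℚ.+ θ)   ≡⟨ cong₂ (λ x y → ℚ.floor (x ℚ.+ θ) ℤ.- ℚ.floor y) Pn≡r (ℚ.+-identityˡ θ) ⟩
    ℚ.floor (fromℤ (+ r) ℚ.+ θ) ℤ.- ℚ.floor θ     ≡⟨ cong (ℤ._- ℚ.floor θ) (floor-fromℤ-+ (+ r) θ) ⟩
    + r ℤ.+ ℚ.floor θ ℤ.- ℚ.floor θ               ≡⟨ add-sub (+ r) (ℚ.floor θ) ⟩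
    + r                                           ∎)
    where
    open ≡-Reasoning
    take-length : take n (toList (round θ)) ≡ toList (round θ)
    take-length = take-all n _ (≤-reflexive (Vec.length-toList (round θ)))
    add-sub : ∀ u v → u ℤ.+ v ℤ.- v ≡ u
    add-sub = solve-∀

  -- The two roundings give the block [b, b′) the sums ⌊x⌋ and -⌊-x⌋ respectively, where x is
  -- the block sum of p; these agree only if x is an integer.
  round-distinct : ∀ {b b′} → b ≤ b′ → b′ ≤ n → (∀ m → psumℚ p b b′ ≢ fromℤ m) →
                   round (ℚ.- P b) ≢ round (ℚ.- P b′)
  round-distinct {b} {b′} b≤b′ b′≤n nonintegral same =
    nonintegral (ℚ.floor x) (floors-cancel⇒integral x (ℚ.- x) (ℚ.+-inverseʳ x) ⌊x⌋+⌊-x⌋≡0)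
    where
    open +-*-Solver
    x = psumℚ p b b′
    x≡ : P b′ ℚ.- P b ≡ x
    x≡ = trans (cong (ℚ._- P b) (sym (P-+-psum b≤b′))) (solve 2 (λ a x → (a :+ x) :- a := x) refl (P b) x)
    -x≡ : P b ℚ.- P b′ ≡ ℚ.- x
    -x≡ = trans (solve 2 (λ a c → a :- c := :- (c :- a)) refl (P b) (P b′)) (cong ℚ.-_ x≡)
    ⌊0⌋ : ∀ y → ℚ.floor (y ℚ.- y) ≡ + 0
    ⌊0⌋ y = cong ℚ.floor (ℚ.+-inverseʳ y)
    blocks : ℚ.floor x ℤ.- + 0 ≡ + 0 ℤ.- ℚ.floor (ℚ.- x)
    blocks = begin
      ℚ.floor x ℤ.- + 0                                    ≡⟨ cong₂ ℤ._-_ (cong ℚ.floor x≡) (⌊0⌋ (P b)) ⟨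
      ℚ.floor (P b′ ℚ.- P b) ℤ.- ℚ.floor (P b ℚ.- P b)       ≡⟨ psum-round (ℚ.- P b) b≤b′ b′≤n ⟨
      + psumℕ (round (ℚ.- P b)) b b′                     ≡⟨ cong (λ v → + psumℕ v b b′) same ⟩
      + psumℕ (round (ℚ.- P b′)) b b′                    ≡⟨ psum-round (ℚ.- P b′) b≤b′ b′≤n ⟩
      ℚ.floor (P b′ ℚ.- P b′) ℤ.- ℚ.floor (P b ℚ.- P b′)     ≡⟨ cong₂ ℤ._-_ (⌊0⌋ (P b′)) (cong ℚ.floor -x≡) ⟩
      + 0 ℤ.- ℚ.floor (ℚ.- x)                              ∎
      where open ≡-Reasoning
    ⌊x⌋+⌊-x⌋≡0 : ℚ.floor x ℤ.+ ℚ.floor (ℚ.- x) ≡ + 0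
    ⌊x⌋+⌊-x⌋≡0 = begin
      ℚ.floor x ℤ.+ ℚ.floor (ℚ.- x)            ≡⟨ cong (ℤ._+ ℚ.floor (ℚ.- x)) (ℤ.+-identityʳ (ℚ.floor x)) ⟨
      ℚ.floor x ℤ.- + 0 ℤ.+ ℚ.floor (ℚ.- x)    ≡⟨ cong (ℤ._+ ℚ.floor (ℚ.- x)) (trans blocks (ℤ.+-identityˡ (ℤ.- ℚ.floor (ℚ.- x)))) ⟩
      ℤ.- ℚ.floor (ℚ.- x) ℤ.+ ℚ.floor (ℚ.- x)  ≡⟨ ℤ.+-inverseˡ (ℚ.floor (ℚ.- x)) ⟩
      + 0                                      ∎
      where open ≡-Reasoning

alcove-vertex-sum : ∀ {r d A} → IsAlcove r d A → ∀ i → Vec.sum (A i) ≡ r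
alcove-vertex-sum {r} {d} {A} (_ , p , p>0 , p-sum , generic , vertices) i =
  begin
    Vec.sum (A i)          ≡⟨ cong (Vec.sum ∘ A) (proj₂ hit) ⟨
    Vec.sum (A (h k))      ≡⟨ cong Vec.sum (proj₂ (vertex-of k)) ⟩
    Vec.sum (point k)      ≡⟨ point-sum k ⟩
    r                      ∎
  where
  open Rounding p p>0

  point : Fin (suc d) → Vec ℕ (suc d)
  point k = round (ℚ.- P (toℕ k))

  point-sum : ∀ k → Vec.sum (point k) ≡ r
  point-sum k = round-sum (ℚ.- P (toℕ k)) r p-sum

  point-distinct : ∀ {k k′} → toℕ k < toℕ k′ → point k ≢ point k′
  point-distinct {k′ = k′} k<k′ = round-distinct (<⇒≤ k<k′) (<⇒≤ (Fin.toℕ<n k′))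
    (generic _ _ k<k′ (<⇒≤ (Fin.toℕ<n k′)) (λ (_ , k′≡) → <⇒≢ (Fin.toℕ<n k′) k′≡))

  point-injective : Injective _≡_ _≡_ point
  point-injective {k} {k′} eq with Fin.<-cmp k k′
  ... | tri< k<k′ _ _ = ⊥-elim (point-distinct k<k′ eq)
  ... | tri≈ _ k≡k′ _ = k≡k′
  ... | tri> _ _ k′<k = ⊥-elim (point-distinct k′<k (sym eq))

  vertex-of : ∀ k → ∃ λ i → A i ≡ point k
  vertex-of k = Equivalence.from (vertices (point k) (point-sum k)) (λ a b → round-inClosure (ℚ.- P (toℕ k)))

  h : Fin (suc d) → Fin (suc d)
  h = proj₁ ∘ vertex-of

  h-injective : Injective _≡_ _≡_ h
  h-injective {k} {k′} hk≡hk′ = point-injective (trans (sym (proj₂ (vertex-of k))) (trans (cong A hk≡hk′) (proj₂ (vertex-of k′))))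

  hit : ∃ λ k → h k ≡ i
  -- eta-expanded: otherwise unification unfolds vertex-of and the check does not finish
  hit = injective⇒surjective h (λ {k} {k′} → h-injective {k} {k′}) i
  k : Fin (suc d)
  k = proj₁ hit
  open ≡-Reasoning

-- Prefix sums of the vertices

-- Intended instance: s a t is the t-th prefix sum of the a-th vertex of a sorted alcove.
module Staircase (d : ℕ) (s : ℕ → ℕ → ℕ)
  (s-box : ∀ {a a′} t → a ≤ d → a′ ≤ d → s a t ≤ suc (s a′ t))
  (s-antitone : ∀ {a} t → a < d → s (suc a) t ≤ s a t)
  (rows-differ : ∀ {a} → a < d → ¬ (∀ t → t < d → s a (suc t) ≡ s (suc a) (suc t))) where

  s-antitone-≤ : ∀ {a a′} t → a ≤ a′ → a′ ≤ d → s a′ t ≤ s a t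
  s-antitone-≤ {a′ = zero}  t z≤n  _     = ≤-refl
  s-antitone-≤ {a′ = suc b} t a≤1+b b<d with m≤n⇒m<n∨m≡n a≤1+b
  ... | inj₂ refl = ≤-refl
  ... | inj₁ a<1+b = ≤-trans (s-antitone t b<d) (s-antitone-≤ t (s≤s⁻¹ a<1+b) (<⇒≤ b<d))

  s-last-≤ : ∀ {a} t → a ≤ d → s d t ≤ s a t
  s-last-≤ t a≤d = s-antitone-≤ t a≤d ≤-refl

  excess : ℕ → ℕ → ℕ
  excess a t = s a (suc t) ∸ s d (suc t)

  step : ℕ → ℕ → ℕ
  step a t = s a (suc t) ∸ s (suc a) (suc t)

  excess≤1 : ∀ {a} t → a ≤ d → excess a t ≤ 1
  excess≤1 {a} t a≤d = subst (excess a t ≤_) (m+n∸n≡m 1 (s d (suc t))) (∸-monoˡ-≤ (s d (suc t)) (s-box (suc t) a≤d ≤-refl))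

  excess-split : ∀ {a} t → a < d → excess a t ≡ step a t + excess (suc a) t
  excess-split {a} t a<d = sym (begin
    (s a (suc t) ∸ s (suc a) (suc t)) + (s (suc a) (suc t) ∸ s d (suc t))
      ≡⟨ +-∸-assoc _ (s-last-≤ (suc t) a<d) ⟨
    (s a (suc t) ∸ s (suc a) (suc t)) + s (suc a) (suc t) ∸ s d (suc t)
      ≡⟨ cong (_∸ s d (suc t)) (m∸n+n≡m (s-antitone (suc t) a<d)) ⟩
    s a (suc t) ∸ s d (suc t) ∎)
    where open ≡-Reasoning

  rowStep : ℕ → ℕ
  rowStep a = ∑< d (step a)

  rowExcess : ℕ → ℕ
  rowExcess a = ∑< d (excess a)

  rowExcess-telescope : ∀ m → m ≤ d → rowExcess 0 ≡ ∑< m rowStep + rowExcess m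
  rowExcess-telescope zero    _   = refl
  rowExcess-telescope (suc m) m<d = begin
    rowExcess 0                                     ≡⟨ rowExcess-telescope m (<⇒≤ m<d) ⟩
    ∑< m rowStep + rowExcess m                      ≡⟨ cong (_+_ (∑< m rowStep)) split ⟩
    ∑< m rowStep + (rowStep m + rowExcess (suc m))  ≡⟨ +-assoc (∑< m rowStep) _ _ ⟨
    ∑< m rowStep + rowStep m + rowExcess (suc m)    ≡⟨ cong (_+ rowExcess (suc m)) (∑<-snoc m rowStep) ⟨
    ∑< (suc m) rowStep + rowExcess (suc m)          ∎
    where
    open ≡-Reasoning
    split : rowExcess m ≡ rowStep m + rowExcess (suc m)
    split = trans (∑<-cong d (λ t _ → excess-split t m<d)) (∑<-distrib-+ d (step m) (excess (suc m)))

  ∑-rowStep : ∑< d rowStep ≡ rowExcess 0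
  ∑-rowStep = sym (begin
    rowExcess 0                    ≡⟨ rowExcess-telescope d ≤-refl ⟩
    ∑< d rowStep + rowExcess d     ≡⟨ cong (_+_ (∑< d rowStep)) rowExcess-last ⟩
    ∑< d rowStep + 0               ≡⟨ +-identityʳ _ ⟩
    ∑< d rowStep                   ∎)
    where
    open ≡-Reasoning
    rowExcess-last : rowExcess d ≡ 0
    rowExcess-last = trans (∑<-cong d (λ t _ → n∸n≡0 (s d (suc t)))) (trans (∑<-const d 0) (*-zeroʳ d))

  rowStep≥1 : ∀ {a} → a < d → 1 ≤ rowStep a
  rowStep≥1 {a} a<d with rowStep a ≟ 0
  ... | no  Σ≢0 = n≢0⇒n>0 Σ≢0
  ... | yes Σ≡0 = ⊥-elim (rows-differ a<d λ t t<d →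
    ≤-antisym (m∸n≡0⇒m≤n (n≤0⇒n≡0 (subst (step a t ≤_) Σ≡0 (∑<-term d (step a) t<d)))) (s-antitone (suc t) a<d))

  -- Every row step is at least 1, while all of them add up to ∑ₜ excess 0 t ≤ d.
  rowStep≡1 : ∀ {a} → a < d → rowStep a ≡ 1
  rowStep≡1 {a} a<d = sym (∑<-≤-pointwise-≡ d (λ _ → rowStep≥1) ∑rowStep≤d a a<d)
    where
    ∑rowStep≤d : ∑< d rowStep ≤ ∑< d (λ _ → 1)
    ∑rowStep≤d = subst₂ _≤_ (sym ∑-rowStep) (sym (∑<-const-1 d)) (∑<-≤-length d (λ t _ → excess≤1 t z≤n))

  excess-first≡1 : ∀ {t} → t < d → excess 0 t ≡ 1
  excess-first≡1 {t} t<d = ∑<-≤-pointwise-≡ d (λ t _ → excess≤1 t z≤n)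
    (≤-reflexive (trans (∑<-const-1 d) (sym (trans (sym ∑-rowStep) (trans (∑<-cong d (λ _ → rowStep≡1)) (∑<-const-1 d)))))) t t<d

  rank : ℕ → ℕ
  rank t = ∑< d (λ a → excess (suc a) t)

  excess≡1⇔≤rank : ∀ {a t} → a ≤ d → t < d → (excess a t ≡ 1 ⇔ a ≤ rank t)
  excess≡1⇔≤rank {zero}  _ t<d = mk⇔ (λ _ → z≤n) (λ _ → excess-first≡1 t<d)
  excess≡1⇔≤rank {suc a} {t} a<d t<d = antitone-01-∑< d (λ a → excess (suc a) t)
    (λ i si<d → subst (excess (suc (suc i)) t ≤_) (sym (excess-split t si<d)) (m≤n+m _ _))
    (λ i i<d → excess≤1 t i<d) a a<d

  rank<d : ∀ {t} → t < d → rank t < d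
  rank<d t<d = ≰⇒> λ d≤rank → 0≢1+n (trans (sym (n∸n≡0 (s d _))) (Equivalence.from (excess≡1⇔≤rank ≤-refl t<d) d≤rank))

  s-above-rank : ∀ {a t} → a ≤ d → t < d → a ≤ rank t → s a (suc t) ≡ suc (s d (suc t))
  s-above-rank {a} {t} a≤d t<d a≤rank = begin
    s a (suc t)                                 ≡⟨ m∸n+n≡m (s-last-≤ (suc t) a≤d) ⟨
    excess a t + s d (suc t)                    ≡⟨ cong (_+ s d (suc t)) (Equivalence.from (excess≡1⇔≤rank a≤d t<d) a≤rank) ⟩
    suc (s d (suc t))                           ∎
    where open ≡-Reasoning

  s-beyond-rank : ∀ {a t} → a ≤ d → t < d → rank t < a → s a (suc t) ≡ s d (suc t)
  s-beyond-rank {a} {t} a≤d t<d rank<a with m≤n⇒m<n∨m≡n (excess≤1 t a≤d)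
  ... | inj₁ excess<1 = ≤-antisym (m∸n≡0⇒m≤n (n<1⇒n≡0 excess<1)) (s-last-≤ (suc t) a≤d)
  ... | inj₂ excess≡1 = ⊥-elim (<⇒≱ rank<a (Equivalence.to (excess≡1⇔≤rank a≤d t<d) excess≡1))

  step-at-rank : ∀ {a t} → a < d → t < d → s (suc a) (suc t) < s a (suc t) → rank t ≡ a
  step-at-rank {a} {t} a<d t<d gap with <-cmp (rank t) a
  ... | tri≈ _ rank≡a _ = rank≡a
  ... | tri< rank<a _ _ = ⊥-elim (<-irrefl (trans (s-beyond-rank a<d t<d (m<n⇒m<1+n rank<a)) (sym (s-beyond-rank (<⇒≤ a<d) t<d rank<a))) gap)
  ... | tri> _ _ a<rank = ⊥-elim (<-irrefl (trans (s-above-rank a<d t<d a<rank) (sym (s-above-rank (<⇒≤ a<d) t<d (<⇒≤ a<rank)))) gap)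

  step-at-rank≡1 : ∀ {t} → t < d → step (rank t) t ≡ 1
  step-at-rank≡1 {t} t<d = begin
    s a (suc t) ∸ s (suc a) (suc t)     ≡⟨ cong₂ _∸_ (s-above-rank (<⇒≤ a<d) t<d ≤-refl) (s-beyond-rank a<d t<d ≤-refl) ⟩
    suc (s d (suc t)) ∸ s d (suc t)     ≡⟨ m+n∸n≡m 1 (s d (suc t)) ⟩
    1                                   ∎
    where
    open ≡-Reasoning
    a = rank t
    a<d = rank<d t<d

  rank-injective : ∀ {t t′} → t < d → t′ < d → rank t ≡ rank t′ → t ≡ t′
  rank-injective {t} {t′} t<d t′<d rank≡ with t ≟ t′
  ... | yes t≡t′ = t≡t′
  ... | no  t≢t′ = ⊥-elim (<-irrefl refl (begin
    2                                   ≡⟨ cong₂ _+_ (step-at-rank≡1 t<d) (subst (λ a → step a t′ ≡ 1) (sym rank≡)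
                                                                                 (step-at-rank≡1 t′<d)) ⟨
    step (rank t) t + step (rank t) t′  ≤⟨ ∑<-two d (step (rank t)) t<d t′<d t≢t′ ⟩
    rowStep (rank t)                    ≡⟨ rowStep≡1 (rank<d t<d) ⟩
    1                                   ∎))
    where open ≤-Reasoning

  rank-surjective : ∀ {a} → a < d → ∃ λ t → t < d × rank t ≡ a
  rank-surjective {a} a<d with ∑<-nonzero d (step a) (λ Σ≡0 → 0≢1+n (trans (sym Σ≡0) (rowStep≡1 a<d)))
  ... | t , t<d , step≢0 = t , t<d , step-at-rank a<d t<d (m∸n≢0⇒n<m step≢0)

-- The decorated matrix and comp(A)

module Alcove (d′ r : ℕ) (A : Fin (suc (suc d′)) → Vec ℕ (suc (suc d′)))
              (isA : IsAlcove r (suc d′) A) (sorted : Sorted r (suc d′) A) where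

  d : ℕ
  d = suc d′

  p : Vec ℚ (suc d)
  p = proj₁ (proj₂ isA)

  A-injective : Injective _≡_ _≡_ A
  A-injective = proj₁ isA

  -- ℕ-indexed like the rows of the decorated matrix; beyond d it is junk (A 0).
  vertex : ℕ → Vec ℕ (suc d)
  vertex a with a <? suc d
  ... | yes a<1+d = A (fromℕ< a<1+d)
  ... | no  _     = A Fin.zero

  vertex-fromℕ< : ∀ {a} (a<1+d : a < suc d) → vertex a ≡ A (fromℕ< a<1+d)
  vertex-fromℕ< {a} a<1+d with a <? suc d
  ... | yes _      = refl
  ... | no  a≮1+d = ⊥-elim (a≮1+d a<1+d)

  vertex-toℕ : ∀ i → vertex (toℕ i) ≡ A i
  vertex-toℕ i = trans (vertex-fromℕ< (Fin.toℕ<n i)) (cong A (Fin.fromℕ<-toℕ i (Fin.toℕ<n i)))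

  row≡ms : ∀ {a} c → a < suc d → row A a c ≡ nth (ms 1 (toList (vertex a))) c
  row≡ms {a} c a<1+d with a <? suc d
  ... | yes _      = cong (λ l → nth l c) (multiset≡ms (A _))
  ... | no  a≮1+d = ⊥-elim (a≮1+d a<1+d)

  vertex-Vec-sum : ∀ {a} → a ≤ d → Vec.sum (vertex a) ≡ r
  vertex-Vec-sum a≤d = trans (cong Vec.sum (vertex-fromℕ< (s≤s a≤d))) (alcove-vertex-sum isA (fromℕ< (s≤s a≤d)))

  vertex-sum : ∀ {a} → a ≤ d → sumℕ (toList (vertex a)) ≡ r
  vertex-sum {a} a≤d = trans (sym (sum-toList (vertex a))) (vertex-Vec-sum a≤d)

  s : ℕ → ℕ → ℕ
  s a t = sumℕ (take t (toList (vertex a)))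

  s-full : ∀ {a t} → a ≤ d → suc d ≤ t → s a t ≡ r
  s-full {a} {t} a≤d 1+d≤t =
    trans (cong sumℕ (take-all t (toList (vertex a)) (subst (_≤ t) (sym (Vec.length-toList (vertex a))) 1+d≤t))) (vertex-sum {a} a≤d)

  s≤r : ∀ {a} t → a ≤ d → s a t ≤ r
  s≤r {a} t a≤d = subst (s a t ≤_) (vertex-sum a≤d) (sum-take≤sum _ t)

  s-mono : ∀ a {t t′} → t ≤ t′ → s a t ≤ s a t′
  s-mono a = sum-take-mono (toList (vertex a))

  prefix-box : ∀ {a} t → a ≤ d → 0 < t → t ≤ suc d →
    (qfloor (psumℚ p 0 t) ℤ.≤ + s a t) × (+ s a t ℤ.≤ qfloor (psumℚ p 0 t) ℤ.+ + 1)
  prefix-box {a} t a≤d 0<t t≤1+d =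
    Equivalence.to (proj₂ (proj₂ (proj₂ (proj₂ (proj₂ isA)))) (vertex a) (vertex-Vec-sum a≤d))
      (fromℕ< (s≤s a≤d) , sym (vertex-fromℕ< (s≤s a≤d))) 0 t 0<t t≤1+d

  s-box : ∀ {a a′} t → a ≤ d → a′ ≤ d → s a t ≤ suc (s a′ t)
  s-box zero    _   _    = z≤n
  s-box {a} {a′} (suc t) a≤d a′≤d with suc t ≤? suc d
  ... | no  1+t≰1+d =
    ≤-trans (≤-reflexive (trans (s-full a≤d (≰⇒≥ 1+t≰1+d)) (sym (s-full a′≤d (≰⇒≥ 1+t≰1+d))))) (n≤1+n _)
  ... | yes 1+t≤1+d = drop-+ (ℤ.≤-trans {j = F ℤ.+ + 1} (proj₂ (prefix-box (suc t) a≤d (s≤s z≤n) 1+t≤1+d))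
                                         (ℤ.+-monoˡ-≤ (+ 1) (proj₁ (prefix-box (suc t) a′≤d (s≤s z≤n) 1+t≤1+d))))
    where
    F = qfloor (psumℚ p 0 (suc t))
    drop-+ : + s a (suc t) ℤ.≤ + s a′ (suc t) ℤ.+ + 1 → s a (suc t) ≤ suc (s a′ (suc t))
    drop-+ (+≤+ s≤s′+1) = subst (s a (suc t) ≤_) (+-comm _ 1) s≤s′+1

  s-antitone : ∀ {a} t → a < d → s (suc a) t ≤ s a t
  s-antitone {a} t a<d = ms-≤⇒sum-take-≥ (toList (vertex a)) (toList (vertex (suc a)))
    (trans (vertex-sum (<⇒≤ a<d)) (sym (vertex-sum a<d)))
    (λ c c<Σ → subst₂ _≤_ (row≡ms c (m<n⇒m<1+n a<d)) (row≡ms c (s≤s a<d))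
                 (proj₁ sorted a c (s≤s a<d) (subst (c <_) (vertex-sum (<⇒≤ a<d)) c<Σ)))
    t

  rows-differ : ∀ {a} → a < d → ¬ (∀ t → t < d → s a (suc t) ≡ s (suc a) (suc t))
  rows-differ {a} a<d same = 1+n≢n (sym a≡1+a)
    where
    same-prefixes : ∀ t → s a t ≡ s (suc a) t
    same-prefixes zero    = refl
    same-prefixes (suc t) with t <? d
    ... | yes t<d = same t t<d
    ... | no  t≮d = trans (s-full (<⇒≤ a<d) (s≤s (≮⇒≥ t≮d))) (sym (s-full a<d (s≤s (≮⇒≥ t≮d))))
    a≡1+a : a ≡ suc a
    a≡1+a = trans (sym (Fin.toℕ-fromℕ< (m<n⇒m<1+n a<d))) (trans (cong toℕ (A-injective
              (trans (sym (vertex-fromℕ< (m<n⇒m<1+n a<d)))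
                     (trans (sum-take-injective (vertex a) (vertex (suc a)) same-prefixes) (vertex-fromℕ< (s≤s a<d))))))
              (Fin.toℕ-fromℕ< (s≤s a<d)))

  open Staircase d s s-box s-antitone rows-differ

  rank⁻¹ : ℕ → ℕ
  rank⁻¹ a with a <? d
  ... | yes a<d = proj₁ (rank-surjective a<d)
  ... | no  _   = 0

  rank⁻¹<d : ∀ {a} → a < d → rank⁻¹ a < d
  rank⁻¹<d {a} a<d with a <? d
  ... | yes a<d′ = proj₁ (proj₂ (rank-surjective a<d′))
  ... | no  a≮d  = ⊥-elim (a≮d a<d)

  rank-rank⁻¹ : ∀ {a} → a < d → rank (rank⁻¹ a) ≡ a
  rank-rank⁻¹ {a} a<d with a <? d
  ... | yes a<d′ = proj₂ (proj₂ (rank-surjective a<d′))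
  ... | no  a≮d  = ⊥-elim (a≮d a<d)

  rank⁻¹-rank : ∀ {t} → t < d → rank⁻¹ (rank t) ≡ t
  rank⁻¹-rank t<d = rank-injective (rank⁻¹<d (rank<d t<d)) t<d (rank-rank⁻¹ (rank<d t<d))

  -- The column of the unique mark between rows a and a + 1.
  column : ℕ → ℕ
  column a = s d (suc (rank⁻¹ a))

  column-rank : ∀ {t} → t < d → column (rank t) ≡ s d (suc t)
  column-rank t<d = cong (s d ∘ suc) (rank⁻¹-rank t<d)

  s-at-column : ∀ {a} → a < d → s a (suc (rank⁻¹ a)) ≡ suc (column a)
  s-at-column a<d = s-above-rank (<⇒≤ a<d) (rank⁻¹<d a<d) (≤-reflexive (sym (rank-rank⁻¹ a<d)))

  s-next-at-column : ∀ {a} → a < d → s (suc a) (suc (rank⁻¹ a)) ≡ column a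
  s-next-at-column a<d = s-beyond-rank a<d (rank⁻¹<d a<d) (≤-reflexive (cong suc (rank-rank⁻¹ a<d)))

  column<r : ∀ {a} → a < d → column a < r
  column<r {a} a<d = subst (_≤ r) (s-at-column a<d) (s≤r (suc (rank⁻¹ a)) (<⇒≤ a<d))

  gap⇔column : ∀ {a c} → a < d → ((∃ λ t → s (suc a) (suc t) ≤ c × c < s a (suc t)) ⇔ column a ≡ c)
  gap⇔column {a} {c} a<d = mk⇔ to from
    where
    to : (∃ λ t → s (suc a) (suc t) ≤ c × c < s a (suc t)) → column a ≡ c
    to (t , lo , hi) with t <? d
    ... | no  t≮d = ⊥-elim (<-irrefl refl (≤-<-trans (≤-trans (≤-reflexive (trans (s-full (<⇒≤ a<d) (s≤s (≮⇒≥ t≮d)))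
                                                                                      (sym (s-full a<d (s≤s (≮⇒≥ t≮d)))))) lo) hi))
    ... | yes t<d = ≤-antisym (subst (_≤ c) (trans (s-beyond-rank a<d t<d (≤-reflexive (cong suc rank≡a))) column≡) lo)
                              (s≤s⁻¹ (subst (c <_) (trans (s-above-rank (<⇒≤ a<d) t<d (≤-reflexive (sym rank≡a))) (cong suc column≡)) hi))
      where
      rank≡a : rank t ≡ a
      rank≡a = step-at-rank a<d t<d (≤-<-trans lo hi)
      column≡ : s d (suc t) ≡ column a
      column≡ = cong (s d ∘ suc) (rank-injective t<d (rank⁻¹<d a<d) (trans rank≡a (sym (rank-rank⁻¹ a<d))))
    from : column a ≡ c → ∃ λ t → s (suc a) (suc t) ≤ c × c < s a (suc t)
    from refl = rank⁻¹ a , ≤-reflexive (s-next-at-column a<d) , ≤-reflexive (sym (s-at-column a<d))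

  mark⇔column : ∀ {a c} → a < d → c < r → (row A a c < row A (suc a) c ⇔ column a ≡ c)
  mark⇔column {a} {c} a<d c<r =
    subst₂ (λ x y → (x < y) ⇔ (column a ≡ c)) (sym (row≡ms c (m<n⇒m<1+n a<d))) (sym (row≡ms c (s≤s a<d)))
      (⇔-trans (ms-entry-<⇔gap (toList (vertex a)) (toList (vertex (suc a)))
                 (subst (c <_) (sym (vertex-sum (<⇒≤ a<d))) c<r) (subst (c <_) (sym (vertex-sum a<d)) c<r))
               (gap⇔column a<d))

  marks : ℕ → List ℕ
  marks c = List.map suc (filter (λ a → column a ≟ c) (upTo d))

  sigma≡concat-marks : sigma r d A ≡ concat (List.map marks (upTo r))
  sigma≡concat-marks = cong concat (map-cong-local (All.applyUpTo⁺₁ id r λ c<r →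
    concat-map-if≡map-filter (λ a → row A a _ <? row A (suc a) _) (λ a → column a ≟ _) suc
      (All.applyUpTo⁺₁ id d (λ a<d → mark⇔column a<d c<r))))

  -- σ_A lists the labels a + 1 ordered by the column of their mark, then by a.
  _≺_ : ℕ → ℕ → Set
  v ≺ w = column (ℕ.pred v) < column (ℕ.pred w) ⊎ (column (ℕ.pred v) ≡ column (ℕ.pred w) × v < w)

  ≺-irrefl : Irreflexive _≡_ _≺_
  ≺-irrefl refl (inj₁ lt)       = <-irrefl refl lt
  ≺-irrefl refl (inj₂ (_ , lt)) = <-irrefl refl lt

  ≺-trans : Transitive _≺_
  ≺-trans (inj₁ lt)        (inj₁ lt′)         = inj₁ (<-trans lt lt′)
  ≺-trans (inj₁ lt)        (inj₂ (eq′ , _))   = inj₁ (<-≤-trans lt (≤-reflexive eq′))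
  ≺-trans (inj₂ (eq , _))  (inj₁ lt′)         = inj₁ (≤-<-trans (≤-reflexive eq) lt′)
  ≺-trans (inj₂ (eq , lt)) (inj₂ (eq′ , lt′)) = inj₂ (trans eq eq′ , <-trans lt lt′)

  marks-column : ∀ c → All (λ v → column (ℕ.pred v) ≡ c) (marks c)
  marks-column c = All.map⁺ (All.all-filter (λ a → column a ≟ c) (upTo d))

  concat-marks-↗ : AllPairs _≺_ (concat (List.map marks (upTo r)))
  concat-marks-↗ = AllPairs.concat⁺ (All.map⁺ (All.universal marks-↗ (upTo r)))
    (AllPairs.map⁺ (AllPairs.applyUpTo⁺₁ id r λ c<c′ _ →
      All.map (λ col≡c → All.map (λ col≡c′ → inj₁ (subst₂ _<_ (sym col≡c) (sym col≡c′) c<c′)) (marks-column _))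
              (marks-column _)))
    where
    marks-↗ : ∀ c → AllPairs _≺_ (marks c)
    marks-↗ c = AllPairs.map⁺ (AllPairs-restrict (λ col≡c col′≡c a<b → inj₂ (trans col≡c (sym col′≡c) , s≤s a<b))
      (All.all-filter (λ a → column a ≟ c) (upTo d)) (AllPairs.filter⁺ (λ a → column a ≟ c) (upTo-↗ d)))

  rank-↗ : AllPairs _≺_ (List.map (suc ∘ rank) (upTo d))
  rank-↗ = AllPairs.map⁺ (AllPairs.applyUpTo⁺₁ id d ordered)
    where
    ordered : ∀ {t t′} → t < t′ → t′ < d → suc (rank t) ≺ suc (rank t′)
    ordered {t} {t′} t<t′ t′<d with <-cmp (rank t) (rank t′) | m≤n⇒m<n∨m≡n (s-mono d (s≤s (<⇒≤ t<t′)))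
    ... | tri≈ _ rank≡ _ | _ = ⊥-elim (<-irrefl (rank-injective (<-trans t<t′ t′<d) t′<d rank≡) t<t′)
    ... | tri< rank< _ _ | inj₁ lt = inj₁ (subst₂ _<_ (sym (column-rank (<-trans t<t′ t′<d))) (sym (column-rank t′<d)) lt)
    ... | tri< rank< _ _ | inj₂ eq = inj₂ (trans (column-rank (<-trans t<t′ t′<d)) (trans eq (sym (column-rank t′<d))) , s≤s rank<)
    ... | tri> _ _ rank> | _ = inj₁ (subst₂ _<_ (sym (column-rank t<d)) (sym (column-rank t′<d)) (subst₂ _≤_
            (s-above-rank a≤d t<d ≤-refl) (s-beyond-rank a≤d t′<d rank>) (s-mono (rank t) (s≤s (<⇒≤ t<t′)))))
      where
      t<d = <-trans t<t′ t′<d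
      a≤d = <⇒≤ (rank<d t<d)

  ∈-concat-marks⁻ : ∀ {v} → v ∈ concat (List.map marks (upTo r)) → ∃ λ a → a < d × v ≡ suc a
  ∈-concat-marks⁻ {v} v∈ = a , ∈.∈-upTo⁻ (proj₁ (∈.∈-filter⁻ (λ a → column a ≟ c) {xs = upTo d} a∈)) , v≡
    where
    found : ∃ λ block → v ∈ block × block ∈ List.map marks (upTo r)
    found = ∈.∈-concat⁻′ (List.map marks (upTo r)) v∈
    block-is-marks : ∃ λ c → c ∈ upTo r × proj₁ found ≡ marks c
    block-is-marks = ∈.∈-map⁻ marks (proj₂ (proj₂ found))
    c : ℕ
    c = proj₁ block-is-marks
    v-marked : ∃ λ a → a ∈ filter (λ a → column a ≟ c) (upTo d) × v ≡ suc a
    v-marked = ∈.∈-map⁻ suc (subst (v ∈_) (proj₂ (proj₂ block-is-marks)) (proj₁ (proj₂ found)))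
    a : ℕ
    a = proj₁ v-marked
    a∈ = proj₁ (proj₂ v-marked)
    v≡ = proj₂ (proj₂ v-marked)

  ∈-concat-marks⁺ : ∀ {a} → a < d → suc a ∈ concat (List.map marks (upTo r))
  ∈-concat-marks⁺ {a} a<d =
    ∈.∈-concat⁺′ (∈.∈-map⁺ suc (∈.∈-filter⁺ (λ x → column x ≟ column a) (∈.∈-upTo⁺ a<d) refl))
                 (∈.∈-map⁺ marks (∈.∈-upTo⁺ (column<r a<d)))

  ∈-map-rank⁻ : ∀ {v} → v ∈ List.map (suc ∘ rank) (upTo d) → ∃ λ a → a < d × v ≡ suc a
  ∈-map-rank⁻ v∈ with t , t∈ , refl ← ∈.∈-map⁻ (suc ∘ rank) v∈ = rank t , rank<d (∈.∈-upTo⁻ t∈) , refl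

  ∈-map-rank⁺ : ∀ {a} → a < d → suc a ∈ List.map (suc ∘ rank) (upTo d)
  ∈-map-rank⁺ a<d = subst (λ a → suc a ∈ _) (rank-rank⁻¹ a<d) (∈.∈-map⁺ (suc ∘ rank) (∈.∈-upTo⁺ (rank⁻¹<d a<d)))

  sigma≡map-rank : sigma r d A ≡ List.map (suc ∘ rank) (upTo d)
  sigma≡map-rank = trans sigma≡concat-marks (sorted-same-elements⇒≡ ≺-irrefl ≺-trans concat-marks-↗ rank-↗
    (λ v∈ → let a , a<d , v≡ = ∈-concat-marks⁻ v∈ in subst (_∈ _) (sym v≡) (∈-map-rank⁺ a<d))
    (λ v∈ → let a , a<d , v≡ = ∈-map-rank⁻ v∈ in subst (_∈ _) (sym v≡) (∈-concat-marks⁺ a<d)))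

  sigma-↭ : sigma r d A ↭ List.map suc (upTo d)
  sigma-↭ = subst (_↭ List.map suc (upTo d)) (sym (trans sigma≡map-rank (map-∘ (upTo d))))
    (↭.map⁺ suc (map-upTo-↭ d rank rank<d rank-injective rank-surjective))

  descents : ℕ
  descents = ∑< d′ (descent (suc ∘ rank))

  des-sigma : des (sigma r d A) ≡ descents
  des-sigma = trans (cong des (trans sigma≡map-rank (map-applyUpTo id (suc ∘ rank) d))) (des-applyUpTo (suc ∘ rank) d′)

  coord : ℕ → ℕ → ℕ
  coord a k = s a (suc k) ∸ s a k

  lookup-vertex : ∀ a (k : Fin (suc d)) → Vec.lookup (vertex a) k ≡ coord a (toℕ k)
  lookup-vertex a k = sym (trans (cong (_∸ s a (toℕ k)) (sym (sum-take-lookup (vertex a) k))) (m+n∸m≡n (s a (toℕ k)) _))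

  -- How far the minimum of coordinate k over the vertices falls below that of the last vertex.
  dip : ℕ → ℕ
  dip zero = 0
  dip (suc t) with suc t <? d
  ... | yes _ = descent (suc ∘ rank) t
  ... | no  _ = 1

  dip-inner : ∀ {t} → suc t < d → dip (suc t) ≡ descent (suc ∘ rank) t
  dip-inner {t} 1+t<d with suc t <? d
  ... | yes _     = refl
  ... | no  1+t≮d = ⊥-elim (1+t≮d 1+t<d)

  dip-last : dip d ≡ 1
  dip-last with d <? d
  ... | yes d<d = ⊥-elim (<-irrefl refl d<d)
  ... | no  _   = refl

  CoordMin : ℕ → ℕ → Set
  CoordMin k δ = (∀ {a} → a ≤ d → coord d k ∸ δ ≤ coord a k) ×
                  (∃ λ a → a ≤ d × coord a k ≡ coord d k ∸ δ) ×
                  δ ≤ coord d k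

  coord-min-at-last : ∀ k → (∀ {a} → a ≤ d → coord d k ≤ coord a k) → CoordMin k 0
  coord-min-at-last k last≤ = last≤ , (d , ≤-refl , refl) , z≤n

  -- A vertex one ahead of the last vertex in prefix sum t + 1 and level with it in prefix sum
  -- t + 2 has coordinate t + 1 one smaller; by s-box no vertex has it smaller still.
  coord-min-dip : ∀ {t a₀} → a₀ ≤ d → s a₀ (suc t) ≡ suc (s d (suc t)) → s a₀ (suc (suc t)) ≡ s d (suc (suc t)) →
                   CoordMin (suc t) 1
  coord-min-dip {t} {a₀} a₀≤d ahead level = lower , (a₀ , a₀≤d , attained) , 1≤
    where
    S₁ = s d (suc t)
    S₂ = s d (suc (suc t))
    ∸-suc : S₂ ∸ S₁ ∸ 1 ≡ S₂ ∸ suc S₁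
    ∸-suc = trans (∸-+-assoc S₂ S₁ 1) (cong (S₂ ∸_) (+-comm S₁ 1))
    lower : ∀ {a} → a ≤ d → coord d (suc t) ∸ 1 ≤ coord a (suc t)
    lower {a} a≤d = subst (_≤ coord a (suc t)) (sym ∸-suc) (∸-mono (s-last-≤ (suc (suc t)) a≤d) (s-box (suc t) a≤d ≤-refl))
    attained : coord a₀ (suc t) ≡ coord d (suc t) ∸ 1
    attained = trans (cong₂ _∸_ level ahead) (sym ∸-suc)
    1≤ : 1 ≤ coord d (suc t)
    1≤ = m<n⇒0<n∸m (subst₂ _≤_ ahead level (s-mono a₀ (n≤1+n (suc t))))

  coord-min : ∀ {k} → k ≤ d → CoordMin k (dip k)
  coord-min {zero}  _     = coord-min-at-last 0 (s-last-≤ 1)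
  coord-min {suc t} t<d with suc t <? d
  ... | no  1+t≮d = coord-min-dip z≤n (s-above-rank z≤n t<d z≤n)
                      (trans (s-full z≤n (s≤s (≮⇒≥ 1+t≮d))) (sym (s-full ≤-refl (s≤s (≮⇒≥ 1+t≮d)))))
  ... | yes 1+t<d with rank (suc t) <? rank t
  ...   | yes rank-drops = subst (CoordMin (suc t)) (sym (descent-yes (suc ∘ rank) (s≤s rank-drops)))
                             (coord-min-dip rank≤d (s-above-rank rank≤d t<d ≤-refl) (s-beyond-rank rank≤d 1+t<d rank-drops))
    where rank≤d = <⇒≤ (rank<d t<d)
  ...   | no  rank-rises = subst (CoordMin (suc t)) (sym (descent-no (suc ∘ rank) (rank-rises ∘ s≤s⁻¹)))
                             (coord-min-at-last (suc t) lower)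
    where
    lower : ∀ {a} → a ≤ d → coord d (suc t) ≤ coord a (suc t)
    lower {a} a≤d with a ≤? rank t
    ... | yes a≤rank = ≤-reflexive (sym (cong₂ _∸_ (s-above-rank a≤d 1+t<d (≤-trans a≤rank (≮⇒≥ rank-rises)))
                                                    (s-above-rank a≤d t<d a≤rank)))
    ... | no  a≰rank = ∸-mono (s-last-≤ (suc (suc t)) a≤d) (≤-reflexive (s-beyond-rank a≤d t<d (≰⇒> a≰rank)))

  lookup-comp : ∀ k → Vec.lookup (comp A) k ≡ coord d (toℕ k) ∸ dip (toℕ k)
  lookup-comp k = trans (Vec.lookup∘tabulate column-of-comp k)
    (foldr-⊓-attained (λ i → Vec.lookup (A i) k) (List.allFin (suc d)) (lower Fin.zero) lower
      (fromℕ< (s≤s a₀≤d) , ∈.∈-allFin _ ,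
       trans (cong (λ v → Vec.lookup v k) (sym (vertex-fromℕ< (s≤s a₀≤d)))) (trans (lookup-vertex a₀ k) attained)))
    where
    column-of-comp : Fin (suc d) → ℕ
    column-of-comp k = List.foldr (λ i m → Vec.lookup (A i) k ⊓ m) (Vec.lookup (A Fin.zero) k) (List.allFin (suc d))
    min = coord-min (s≤s⁻¹ (Fin.toℕ<n k))
    a₀ = proj₁ (proj₁ (proj₂ min))
    a₀≤d = proj₁ (proj₂ (proj₁ (proj₂ min)))
    attained = proj₂ (proj₂ (proj₁ (proj₂ min)))
    lower : ∀ i → coord d (toℕ k) ∸ dip (toℕ k) ≤ Vec.lookup (A i) k
    lower i = subst (_ ≤_) (sym (trans (cong (λ v → Vec.lookup v k) (sym (vertex-toℕ i))) (lookup-vertex (toℕ i) k)))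
                (proj₁ min (s≤s⁻¹ (Fin.toℕ<n i)))

  dip-sum : ∑< (suc d) dip ≡ suc descents
  dip-sum = begin
    ∑< d (dip ∘ suc)                   ≡⟨ ∑<-snoc d′ (dip ∘ suc) ⟩
    ∑< d′ (dip ∘ suc) + dip d          ≡⟨ cong₂ _+_ (∑<-cong d′ (λ _ t<d′ → dip-inner (s≤s t<d′))) dip-last ⟩
    descents + 1                       ≡⟨ +-comm descents 1 ⟩
    suc descents                       ∎
    where open ≡-Reasoning

  coord-sum : ∑< (suc d) (coord d) ≡ r
  coord-sum = begin
    ∑< (suc d) (coord d)                          ≡⟨ ∑<-tabulate (suc d) (coord d) ⟨
    Vec.sum (Vec.tabulate {n = suc d} (coord d ∘ toℕ)) ≡⟨ cong Vec.sum (Vec.tabulate-cong (sym ∘ lookup-vertex d)) ⟩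
    Vec.sum (Vec.tabulate (Vec.lookup (vertex d))) ≡⟨ cong Vec.sum (Vec.tabulate∘lookup (vertex d)) ⟩
    Vec.sum (vertex d)                            ≡⟨ vertex-Vec-sum ≤-refl ⟩
    r                                             ∎
    where open ≡-Reasoning

  comp-sum : Vec.sum (comp A) + suc descents ≡ r
  comp-sum = begin
    Vec.sum (comp A) + suc descents
      ≡⟨ cong₂ _+_ (cong Vec.sum (Vec.tabulate∘lookup (comp A))) dip-sum ⟨
    Vec.sum (Vec.tabulate (Vec.lookup (comp A))) + ∑< (suc d) dip
      ≡⟨ cong (_+ ∑< (suc d) dip) (trans (cong Vec.sum (Vec.tabulate-cong {g = λ k → coord d (toℕ k) ∸ dip (toℕ k)} lookup-comp))
                                         (∑<-tabulate (suc d) (λ k → coord d k ∸ dip k))) ⟩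
    ∑< (suc d) (λ k → coord d k ∸ dip k) + ∑< (suc d) dip
      ≡⟨ ∑<-distrib-+ (suc d) (λ k → coord d k ∸ dip k) dip ⟨
    ∑< (suc d) (λ k → coord d k ∸ dip k + dip k)
      ≡⟨ ∑<-cong (suc d) {g = coord d} (λ k k<1+d → m∸n+n≡m (proj₂ (proj₂ (coord-min (s≤s⁻¹ k<1+d))))) ⟩
    ∑< (suc d) (coord d)
      ≡⟨ coord-sum ⟩
    r ∎
    where open ≡-Reasoning

  descents<d : descents < d
  descents<d = s≤s (∑<-≤-length d′ (λ t _ → descent≤1 (suc ∘ rank) t))

proposition3p13 : (d r : ℕ) → 1 ≤ d → 1 ≤ r →
    (A : Fin (suc d) → Vec ℕ (suc d)) → IsAlcove r d A → Sorted r d A →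
    Σ ℕ λ j → (1 ≤ j) × (j ≤ d) × (j ≤ r) ×
      InC (r ∸ 1) (suc d) (r ∸ j) (comp A) × InEulerian d j (sigma r d A)
proposition3p13 (suc d′) r _ _ A isA sorted =
  suc descents , s≤s z≤n , descents<d , j≤r , (sum-comp , comp≤r∸1) , (sigma-↭ , des-sigma)
  where
  open Alcove d′ r A isA sorted
  j≤r : suc descents ≤ r
  j≤r = subst (suc descents ≤_) comp-sum (m≤n+m _ _)
  sum-comp : Vec.sum (comp A) ≡ r ∸ suc descents
  sum-comp = trans (sym (m+n∸n≡m _ (suc descents))) (cong (_∸ suc descents) comp-sum)
  comp≤r∸1 : ∀ k → Vec.lookup (comp A) k ≤ r ∸ 1
  comp≤r∸1 k = ≤-trans (lookup≤sum (comp A) k) (subst (_≤ r ∸ 1) (sym sum-comp) (∸-monoʳ-≤ r (s≤s z≤n)))
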